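{- Let $\alpha=(\alpha_1,\dots,\alpha_n)$ and $\beta=(\beta_1,\dots,\beta_m)$ be two compositions. Then \[ \eta_{\alpha}^{(q)}\eta_{\beta}^{(q)}=\sum_{\substack{\gamma\in \mathrm{Sh}(\alpha,\beta);\\ I \subseteq T_{\beta}(\gamma) \setminus \{n+m\};\\ J\subseteq T_{\beta}(\gamma) \setminus \{1, n+m\};\\ I\cap J=\emptyset}}(q-1)^{|I|}(-q)^{|J|}\,\eta^{(q)}_{\gamma^{\downarrow I\downarrow\downarrow J}}, \] where $\mathrm{Sh}(\alpha,\beta)$ is the multiset of compositions obtained by shuffling $\alpha$ and $\beta$ (written $\alpha\sqcup\!\sqcup\beta$ with the shuffle symbol in the paper).
   Context: Let $\mathbf{k}$ be a commutative ring, $q\in\mathbf{k}$, and $X=\{x_1,x_2,\dots\}$ indeterminates. For a composition $\alpha=(\alpha_1,\dots,\alpha_n)$, the enriched $q$-monomial is $\eta^{(q)}_\alpha=\sum_{i_1\le i_2\le\cdots\le i_n}(q+1)^{|\{i_1,\dots,i_n\}|}x_{i_1}^{\alpha_1}\cdots x_{i_n}^{\alpha_n}$. For $1\le i\le n-1$, $\alpha^{\downarrow i}=(\alpha_1,\dots,\alpha_{i-1},\alpha_i+\alpha_{i+1},\alpha_{i+2},\dots,\alpha_n)$; for $I=\{i_1<\cdots<i_k\}\subseteq[n-1]$, $\alpha^{\downarrow I}$ is obtained by applying $\downarrow i_k$, then $\downarrow i_{k-1}$, ..., then $\downarrow i_1$; and $\alpha^{\downarrow I\downarrow\downarrow J}=\alpha^{\downarrow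 K}$ with $K=I\cup J\cup(J-1)$, where $J-1=\{j-1: j\in J\}$. Given $\gamma$ in the multiset of shuffles of $\alpha$ and $\beta$ (a composition with $n+m$ entries), $S_\beta(\gamma)$ is the set of positions of the entries of $\beta$ in $\gamma$, $S_\beta(\gamma)-1=\{i-1: i\in S_\beta(\gamma)\}$, and $T_\beta(\gamma)=S_\beta(\gamma)\setminus(S_\beta(\gamma)-1)$. -}

module Defs where

open import Data.Nat using (ℕ; zero; suc; _+_; _∸_; _<_)
open import Data.Bool using (Bool; true; false; _∧_; _∨_; not; if_then_else_)
open import Data.List using (List; []; _∷_; _++_; map; concatMap; length; upTo; foldr; zipWith)
open import Data.List.Relation.Unary.All using (All)
open import Data.Product using (_×_; _,_; proj₁; proj₂)
open import Relation.Nullary.Decidable using (⌊_⌋)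
open import Algebra.Bundles using (CommutativeRing)
import Data.Nat as N
import Data.List.Properties as LP

IsComposition : List ℕ → Set
IsComposition α = All (λ a → 0 < a) α

_==_ : ℕ → ℕ → Bool
a == b = ⌊ a N.≟ b ⌋

mem : ℕ → List ℕ → Bool
mem a []       = false
mem a (b ∷ bs) = (a == b) ∨ mem a bs

eqList : List ℕ → List ℕ → Bool
eqList xs ys = ⌊ LP.≡-dec N._≟_ xs ys ⌋

bfilter : {A : Set} → (A → Bool) → List A → List A
bfilter p []       = []
bfilter p (x ∷ xs) = if p x then x ∷ bfilter p xs else bfilter p xs

range : ℕ → ℕ → List ℕ
range lo hi = map (lo +_) (upTo (hi ∸ lo))

wseq : ℕ → ℕ → ℕ → List (List ℕ)
wseq k zero    lo = [] ∷ []
wseq k (suc n) lo = concatMap (λ i → map (i ∷_) (wseq k n i)) (range lo k)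

-- exponent of x_p in x_{i_1}^{α_1} ⋯ x_{i_n}^{α_n}  (variables indexed from 0)
expoAt : ℕ → List ℕ → List ℕ → ℕ
expoAt p (i ∷ is) (a ∷ as) = (if p == i then a else 0) + expoAt p is as
expoAt p _ _ = 0

expo : ℕ → List ℕ → List ℕ → List ℕ
expo k is α = map (λ p → expoAt p is α) (upTo k)

distinct : ℕ → List ℕ → ℕ
distinct k is = length (bfilter (λ p → mem p is) (upTo k))

boxes : List ℕ → List (List ℕ)
boxes []       = [] ∷ []
boxes (a ∷ as) = concatMap (λ b → map (b ∷_) (boxes as)) (upTo (suc a))

-- Shuffles of xs and ys, each paired with the (1-based) positions of the
-- entries of ys in the shuffle; `off` = number of letters already placed.
-- Every interleaving occurs exactly once: this is the multiset Sh(xs, ys)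
-- together with S_ys(γ).
shuf : ℕ → List ℕ → List ℕ → List (List ℕ × List ℕ)
shuf off [] ys = (ys , map (λ j → suc off + j) (upTo (length ys))) ∷ []
shuf off (x ∷ xs) [] = (x ∷ xs , []) ∷ []
shuf off (x ∷ xs) (y ∷ ys) =
  map (λ p → (x ∷ proj₁ p , proj₂ p)) (shuf (suc off) xs (y ∷ ys))
  ++ map (λ p → (y ∷ proj₁ p , suc off ∷ proj₂ p)) (shuf (suc off) (x ∷ xs) ys)

Sh : List ℕ → List ℕ → List (List ℕ × List ℕ)
Sh = shuf 0

-- T_β(γ) = S \ (S - 1), from S = S_β(γ)
Tset : List ℕ → List ℕ
Tset S = bfilter (λ s → not (mem (suc s) S)) S

without : List ℕ → List ℕ → List ℕ
without R xs = bfilter (λ x → not (mem x R)) xs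

subs : List ℕ → List (List ℕ)
subs []       = [] ∷ []
subs (x ∷ xs) = subs xs ++ map (x ∷_) (subs xs)

disjoint : List ℕ → List ℕ → Bool
disjoint I J = foldr (λ i b → not (mem i J) ∧ b) true I

-- α^{↓i}  (1-based i): merge entries i and i+1
down1 : ℕ → List ℕ → List ℕ
down1 (suc zero)    (a ∷ b ∷ r) = (a + b) ∷ r
down1 (suc (suc i)) (a ∷ r)     = a ∷ down1 (suc i) r
down1 _             xs          = xs

-- α^{↓K} for K = {k_1 < ⋯ < k_r} given as an increasing list:
-- apply ↓k_r first, then ↓k_{r-1}, …, finally ↓k_1.
downK : List ℕ → List ℕ → List ℕ
downK K α = foldr down1 α K

-- α^{↓I ↓↓J} = α^{↓K},  K = I ∪ J ∪ (J-1), listed increasingly within [1, length α - 1]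
downIJ : List ℕ → List ℕ → List ℕ → List ℕ
downIJ α I J =
  downK (bfilter (λ k → mem k I ∨ mem k J ∨ mem (suc k) J) (range 1 (length α))) α

-- A formal power series in x_1, x_2, … is represented by its coefficient
-- function on exponent vectors e = (e_1, …, e_k) (monomial
-- x_1^{e_1} ⋯ x_k^{e_k}; trailing zeros do not matter).

module Enriched {c ℓ} (R : CommutativeRing c ℓ) (q : CommutativeRing.Carrier R) where
  open CommutativeRing R renaming (_+_ to _+R_; _*_ to _*R_)

  Series : Set c
  Series = List ℕ → Carrier

  pow : Carrier → ℕ → Carrier
  pow x zero    = 1#
  pow x (suc n) = x *R pow x n

  rsum : List Carrier → Carrier
  rsum = foldr _+R_ 0#

  -- coefficient of x^e in η^{(q)}_α :
  -- sum over i_1 ≤ ⋯ ≤ i_n of (q+1)^{|{i_1..i_n}|} [x_{i_1}^{α_1}⋯x_{i_n}^{α_n} = x^e].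
  -- Since every α_j > 0, only indices among the first (length e) variables
  -- can contribute, so the (infinite) index range is truncated there.
  η : List ℕ → Series
  η α e = rsum (map (λ is → if eqList (expo (length e) is α) e
                              then pow (q +R 1#) (distinct (length e) is)
                              else 0#)
                    (wseq (length e) (length α) 0))

  _⊗_ : Series → Series → Series
  (f ⊗ g) e = rsum (map (λ e' → f e' *R g (zipWith _∸_ e e')) (boxes e))

  rhs : List ℕ → List ℕ → Series
  rhs α β e =
    rsum (map (λ γS →
      let γ = proj₁ γS
          T = Tset (proj₂ γS)
          N = length α + length β
      in rsum (map (λ I →
           rsum (map (λ J →
             if disjoint I J
             then pow (q - 1#) (length I) *R pow (- q) (length J) *R η (downIJ γ I J) e
             else 0#)
           (subs (without (1 ∷ N ∷ []) T))))
         (subs (without (N ∷ []) T))))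
    (Sh α β))

-- Both sides are compared coefficient by coefficient, by induction on the number of variables.
-- The variable x₀ takes a prefix of each composition, so the coefficients of η α ⊗ η β satisfy
-- a recursion over pairs of prefixes (p letters of α, s letters of β) with weight
-- (q+1)^[p>0] (q+1)^[s>0].
-- On the right, for a shuffle γ with T = T_β(γ), the elements of T are at least two apart, so the
-- sum over I and J is a product of commuting operators 1 + (q-1)↓t + (-q)↓(t-1)↓t, t ∈ T
-- (without the second term at t = n+m, without the third at t = 1 and t = n+m).
-- These operators commute with cutting γ after x₀'s block, which gives the right-hand side the
-- same recursion: a cut shuffle is a shuffle of two prefixes followed by a shuffle of the rest,
-- and summing the operators' scalar factors over the shuffles of the prefixes yields
-- (q+1)^[p>0] (q+1)^[s>0] / (q+1)^[p+s>0], which is 1 or q + 1.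

module Submission where

open import Defs
open import Data.Nat as N using (ℕ; zero; suc; _∸_; _<_; _≤_; z≤n; s≤s; _<ᵇ_; _≤ᵇ_)
open import Data.Nat.ListAction using (sum)
import Data.Nat.Properties as NP
open import Data.Bool using (Bool; true; false; _∧_; _∨_; not; if_then_else_)
import Data.Bool.Properties as BP
open import Data.List using (List; []; _∷_; _++_; map; concatMap; length; upTo; applyUpTo; zipWith; take; drop; replicate; null)
import Data.List.Properties as LP
open import Data.List.Relation.Unary.All as All using (All; []; _∷_)
import Data.List.Relation.Unary.All.Properties as AllP
open import Data.Product using (_×_; _,_; proj₁; proj₂)
open import Data.Unit using (⊤; tt)
open import Data.Sum using (inj₁; inj₂)
open import Function using (_∘_; id)
open import Relation.Nullary using (Dec; yes; no; contradiction)
open import Relation.Nullary.Decidable using (isYes≗does)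
open import Relation.Binary.Definitions using (tri<; tri≈; tri>)
open import Relation.Binary.PropositionalEquality as P using (_≡_; _≢_)
open import Algebra.Bundles using (CommutativeRing)
import Algebra.Solver.CommutativeMonoid as CMSolver
import Algebra.Properties.CommutativeSemigroup as CommSemigroupProperties

==-≡ : ∀ {i j} → i ≡ j → (i == j) ≡ true
==-≡ {i} {j} i≡j with i N.≟ j
... | yes _   = P.refl
... | no i≢j = contradiction i≡j i≢j

==-≢ : ∀ {i j} → i ≢ j → (i == j) ≡ false
==-≢ {i} {j} i≢j with i N.≟ j
... | yes i≡j = contradiction i≡j i≢j
... | no _    = P.refl

==-refl : ∀ i → (i == i) ≡ true
==-refl i = ==-≡ P.refl

==-suc : ∀ i j → (suc i == suc j) ≡ (i == j)
==-suc i j = P.trans (isYes≗does (suc i N.≟ suc j)) (P.sym (isYes≗does (i N.≟ j)))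

eqList-∷ : ∀ a as b bs → eqList (a ∷ as) (b ∷ bs) ≡ (a == b) ∧ eqList as bs
eqList-∷ a as b bs = P.trans (isYes≗does (LP.≡-dec N._≟_ (a ∷ as) (b ∷ bs)))
  (P.sym (P.cong₂ _∧_ (isYes≗does (a N.≟ b)) (isYes≗does (LP.≡-dec N._≟_ as bs))))

applyUpTo-cong : ∀ {a} {A : Set a} {f g : ℕ → A} k → (∀ i → f i ≡ g i) → applyUpTo f k ≡ applyUpTo g k
applyUpTo-cong zero    f≗g = P.refl
applyUpTo-cong (suc k) f≗g = P.cong₂ _∷_ (f≗g 0) (applyUpTo-cong k (f≗g ∘ suc))

range-suc : ∀ lo k → range (suc lo) (suc k) ≡ map suc (range lo k)
range-suc lo k = LP.map-∘ (upTo (k ∸ lo))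

range-0 : ∀ k → range 0 (suc k) ≡ 0 ∷ range 1 (suc k)
range-0 k = P.cong (0 ∷_) (P.trans (LP.map-applyUpTo suc (0 N.+_) k) (P.sym (LP.map-applyUpTo id (1 N.+_) k)))

-- Index sequences in which exactly the first p letters use the variable x₀.

pad : ℕ → List ℕ → List ℕ
pad p js = replicate p 0 ++ map suc js

sgn : ℕ → ℕ
sgn zero    = 0
sgn (suc _) = 1

expoAt-0-map-suc : ∀ js δ → expoAt 0 (map suc js) δ ≡ 0
expoAt-0-map-suc []       δ       = P.refl
expoAt-0-map-suc (j ∷ js) []      = P.refl
expoAt-0-map-suc (j ∷ js) (a ∷ δ) = expoAt-0-map-suc js δ

expoAt-0-pad : ∀ p js δ → expoAt 0 (pad p js) δ ≡ sum (take p δ)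
expoAt-0-pad zero    js δ       = expoAt-0-map-suc js δ
expoAt-0-pad (suc p) js []      = P.refl
expoAt-0-pad (suc p) js (a ∷ δ) = P.cong (a N.+_) (expoAt-0-pad p js δ)

expoAt-suc-pad : ∀ i p js δ → expoAt (suc i) (pad p js) δ ≡ expoAt i js (drop p δ)
expoAt-suc-pad i zero    []       δ       = P.refl
expoAt-suc-pad i zero    (j ∷ js) []      = P.refl
expoAt-suc-pad i zero    (j ∷ js) (a ∷ δ) rewrite ==-suc i j =
  P.cong ((if i == j then a else 0) N.+_) (expoAt-suc-pad i zero js δ)
expoAt-suc-pad i (suc p) []       []      = P.refl
expoAt-suc-pad i (suc p) (j ∷ js) []      = P.refl
expoAt-suc-pad i (suc p) js       (a ∷ δ) = expoAt-suc-pad i p js δ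

expo-pad : ∀ k p js δ → expo (suc k) (pad p js) δ ≡ sum (take p δ) ∷ expo k js (drop p δ)
expo-pad k p js δ = P.cong₂ _∷_ (expoAt-0-pad p js δ) (begin
  map (λ x → expoAt x (pad p js) δ) (applyUpTo suc k)     ≡⟨ LP.map-applyUpTo suc _ k ⟩
  applyUpTo (λ i → expoAt (suc i) (pad p js) δ) k         ≡⟨ applyUpTo-cong k (λ i → expoAt-suc-pad i p js δ) ⟩
  applyUpTo (λ i → expoAt i js (drop p δ)) k              ≡⟨ LP.map-applyUpTo id _ k ⟨
  map (λ x → expoAt x js (drop p δ)) (upTo k)             ∎)
  where open P.≡-Reasoning

mem-suc-pad : ∀ i p js → mem (suc i) (pad p js) ≡ mem i js
mem-suc-pad i zero    []       = P.refl
mem-suc-pad i zero    (j ∷ js) rewrite ==-suc i j = P.cong ((i == j) ∨_) (mem-suc-pad i zero js)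
mem-suc-pad i (suc p) js       = mem-suc-pad i p js

mem-0-pad : ∀ p js → mem 0 (pad p js) ≡ not (p == 0)
mem-0-pad zero    []       = P.refl
mem-0-pad zero    (j ∷ js) = mem-0-pad zero js
mem-0-pad (suc p) js       = P.refl

length-bfilter-applyUpTo : ∀ (b c : ℕ → Bool) (f g : ℕ → ℕ) k → (∀ i → b (f i) ≡ c (g i)) →
  length (bfilter b (applyUpTo f k)) ≡ length (bfilter c (applyUpTo g k))
length-bfilter-applyUpTo b c f g zero    eq = P.refl
length-bfilter-applyUpTo b c f g (suc k) eq rewrite eq 0 with c (g 0)
... | true  = P.cong suc (length-bfilter-applyUpTo b c (f ∘ suc) (g ∘ suc) k (eq ∘ suc))
... | false = length-bfilter-applyUpTo b c (f ∘ suc) (g ∘ suc) k (eq ∘ suc)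

length-bfilter-∷ : ∀ (b : ℕ → Bool) x xs → length (bfilter b (x ∷ xs)) ≡ (if b x then 1 else 0) N.+ length (bfilter b xs)
length-bfilter-∷ b x xs with b x
... | true  = P.refl
... | false = P.refl

distinct-pad : ∀ k p js → distinct (suc k) (pad p js) ≡ sgn p N.+ distinct k js
distinct-pad k p js = P.trans (length-bfilter-∷ (λ x → mem x (pad p js)) 0 (applyUpTo suc k))
  (P.cong₂ N._+_ (head p)
    (length-bfilter-applyUpTo (λ x → mem x (pad p js)) (λ x → mem x js) suc id k (λ i → mem-suc-pad i p js)))
  where
  head : ∀ p → (if mem 0 (pad p js) then 1 else 0) ≡ sgn p
  head p rewrite mem-0-pad p js with p
  ... | zero  = P.refl
  ... | suc _ = P.refl

-- Shuffles as words whose letters are tagged by the factor they come from (true: β)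

Word : Set
Word = List (ℕ × Bool)

tagged : Bool → List ℕ → Word
tagged b = map (_, b)

shuffles : List ℕ → List ℕ → List Word
shuffles []       ys       = tagged true ys ∷ []
shuffles (x ∷ xs) []       = tagged false (x ∷ xs) ∷ []
shuffles (x ∷ xs) (y ∷ ys) = map ((x , false) ∷_) (shuffles xs (y ∷ ys)) ++ map ((y , true) ∷_) (shuffles (x ∷ xs) ys)

shuffles-[] : ∀ xs → shuffles xs [] ≡ tagged false xs ∷ []
shuffles-[] []      = P.refl
shuffles-[] (_ ∷ _) = P.refl

letters : Word → List ℕ
letters = map proj₁

flags : Word → List Bool
flags = map proj₂

letters-tagged : ∀ b xs → letters (tagged b xs) ≡ xs
letters-tagged b xs = P.trans (P.sym (LP.map-∘ xs)) (LP.map-id xs)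

length-shuffles : ∀ xs ys → All (λ w → length w ≡ length xs N.+ length ys) (shuffles xs ys)
length-shuffles []       ys       = LP.length-map _ ys ∷ []
length-shuffles (x ∷ xs) []       = P.trans (LP.length-map _ (x ∷ xs)) (P.sym (NP.+-identityʳ _)) ∷ []
length-shuffles (x ∷ xs) (y ∷ ys) = AllP.++⁺
  (AllP.map⁺ (All.map (P.cong suc) (length-shuffles xs (y ∷ ys))))
  (AllP.map⁺ (All.map (λ eq → P.trans (P.cong suc eq) (P.sym (NP.+-suc (suc (length xs)) (length ys)))) (length-shuffles (x ∷ xs) ys)))

sum-shuffles : ∀ xs ys → All (λ w → sum (letters w) ≡ sum xs N.+ sum ys) (shuffles xs ys)
sum-shuffles []       ys       = P.cong sum (letters-tagged true ys) ∷ []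
sum-shuffles (x ∷ xs) []       = P.trans (P.cong sum (letters-tagged false (x ∷ xs))) (P.sym (NP.+-identityʳ _)) ∷ []
sum-shuffles (x ∷ xs) (y ∷ ys) = AllP.++⁺
  (AllP.map⁺ (All.map (λ eq → P.trans (P.cong (x N.+_) eq) (P.sym (NP.+-assoc x (sum xs) _))) (sum-shuffles xs (y ∷ ys))))
  (AllP.map⁺ (All.map (λ eq → P.trans (P.cong (y N.+_) eq) (x∙yz≈y∙xz y (sum (x ∷ xs)) (sum ys))) (sum-shuffles (x ∷ xs) ys)))
  where open CommSemigroupProperties NP.+-commutativeSemigroup using (x∙yz≈y∙xz)

positions : ℕ → List Bool → List ℕ
positions k []           = []
positions k (true ∷ bs)  = k ∷ positions (suc k) bs
positions k (false ∷ bs) = positions (suc k) bs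

positions-tagged-true : ∀ k ys → positions k (flags (tagged true ys)) ≡ map (k N.+_) (upTo (length ys))
positions-tagged-true k []       = P.refl
positions-tagged-true k (y ∷ ys) = P.cong₂ _∷_ (P.sym (NP.+-identityʳ k)) (begin
  positions (suc k) (flags (tagged true ys))     ≡⟨ positions-tagged-true (suc k) ys ⟩
  map (suc k N.+_) (upTo (length ys))            ≡⟨ LP.map-applyUpTo id _ (length ys) ⟩
  applyUpTo (suc k N.+_) (length ys)             ≡⟨ applyUpTo-cong (length ys) (λ i → NP.+-suc k i) ⟨
  applyUpTo (λ i → k N.+ suc i) (length ys)      ≡⟨ LP.map-applyUpTo suc _ (length ys) ⟨
  map (k N.+_) (applyUpTo suc (length ys))       ∎)
  where open P.≡-Reasoning

positions-tagged-false : ∀ k xs → positions k (flags (tagged false xs)) ≡ []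
positions-tagged-false k []       = P.refl
positions-tagged-false k (x ∷ xs) = positions-tagged-false (suc k) xs

positions-≥ : ∀ k bs → All (k ≤_) (positions k bs)
positions-≥ k []           = []
positions-≥ k (true ∷ bs)  = NP.≤-refl ∷ All.map (NP.≤-trans (NP.n≤1+n k)) (positions-≥ (suc k) bs)
positions-≥ k (false ∷ bs) = All.map (NP.≤-trans (NP.n≤1+n k)) (positions-≥ (suc k) bs)

positions-< : ∀ k bs → All (_< k N.+ length bs) (positions k bs)
positions-< k []           = []
positions-< k (true ∷ bs)  rewrite NP.+-suc k (length bs) = s≤s (NP.m≤m+n k (length bs)) ∷ positions-< (suc k) bs
positions-< k (false ∷ bs) rewrite NP.+-suc k (length bs) = positions-< (suc k) bs

-- The shuffle word w corresponds to the pair (γ, S_β(γ)) of Defs.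
encode : ℕ → Word → List ℕ × List ℕ
encode off w = letters w , positions (suc off) (flags w)

shuf≡map-encode : ∀ off xs ys → shuf off xs ys ≡ map (encode off) (shuffles xs ys)
shuf≡map-encode off []       ys       =
  P.cong (_∷ []) (P.cong₂ _,_ (P.sym (letters-tagged true ys)) (P.sym (positions-tagged-true (suc off) ys)))
shuf≡map-encode off (x ∷ xs) []       =
  P.cong (_∷ []) (P.cong₂ _,_ (P.sym (letters-tagged false (x ∷ xs))) (P.sym (positions-tagged-false (suc off) (x ∷ xs))))
shuf≡map-encode off (x ∷ xs) (y ∷ ys) = P.trans
  (P.cong₂ _++_
    (P.trans (P.cong (map _) (shuf≡map-encode (suc off) xs (y ∷ ys))) (reorder (x , false) (shuffles xs (y ∷ ys)) (λ _ → P.refl)))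
    (P.trans (P.cong (map _) (shuf≡map-encode (suc off) (x ∷ xs) ys)) (reorder (y , true) (shuffles (x ∷ xs) ys) (λ _ → P.refl))))
  (P.sym (LP.map-++ (encode off) (map ((x , false) ∷_) (shuffles xs (y ∷ ys))) (map ((y , true) ∷_) (shuffles (x ∷ xs) ys))))
  where
  reorder : ∀ {g : List ℕ × List ℕ → List ℕ × List ℕ} l ws → (∀ w → g (encode (suc off) w) ≡ encode off (l ∷ w)) →
            map g (map (encode (suc off)) ws) ≡ map (encode off) (map (l ∷_) ws)
  reorder l ws eq = P.trans (P.sym (LP.map-∘ ws)) (P.trans (LP.map-cong eq ws) (LP.map-∘ ws))

notHead : List Bool → Bool
notHead []      = true
notHead (b ∷ _) = not b

-- Marks the last letter of each maximal run of β-letters: T_β(γ) in terms of flags.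
runEnds : List Bool → List Bool
runEnds []       = []
runEnds (b ∷ bs) = (b ∧ notHead bs) ∷ runEnds bs

notHead-take : ∀ r bs → notHead (take (suc r) bs) ≡ notHead bs
notHead-take r []      = P.refl
notHead-take r (_ ∷ _) = P.refl

length-runEnds : ∀ bs → length (runEnds bs) ≡ length bs
length-runEnds []       = P.refl
length-runEnds (b ∷ bs) = P.cong suc (length-runEnds bs)

mem-< : ∀ m S → All (m <_) S → mem m S ≡ false
mem-< m []      []              = P.refl
mem-< m (s ∷ S) (m<s ∷ m<S) = P.cong₂ _∨_ (==-≢ λ m≡s → NP.<-irrefl m≡s m<s) (mem-< m S m<S)

bfilter-congᴬ : ∀ {A : Set} {P : A → Set} (f g : A → Bool) {xs : List A} → All P xs → (∀ x → P x → f x ≡ g x) →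
                bfilter f xs ≡ bfilter g xs
bfilter-congᴬ f g []         eq = P.refl
bfilter-congᴬ f g {x ∷ xs} (px ∷ pxs) eq rewrite eq x px with g x
... | true  = P.cong (x ∷_) (bfilter-congᴬ f g pxs eq)
... | false = bfilter-congᴬ f g pxs eq

mem-positions-head : ∀ k bs → mem k (positions k bs) ≡ not (notHead bs)
mem-positions-head k []           = P.refl
mem-positions-head k (true ∷ bs)  = P.cong (_∨ mem k (positions (suc k) bs)) (==-refl k)
mem-positions-head k (false ∷ bs) = mem-< k (positions (suc k) bs) (positions-≥ (suc k) bs)

Tset-positions : ∀ k bs → Tset (positions k bs) ≡ positions k (runEnds bs)
Tset-positions k []           = P.refl
Tset-positions k (false ∷ bs) = Tset-positions (suc k) bs
Tset-positions k (true ∷ bs)  = goal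
  where
  S = positions (suc k) bs
  rest : bfilter (λ s → not (mem (suc s) (k ∷ S))) S ≡ positions (suc k) (runEnds bs)
  rest = P.trans (bfilter-congᴬ _ _ (positions-≥ (suc k) bs)
                   (λ s k<s → P.cong (λ b → not (b ∨ mem (suc s) S)) (==-≢ λ s+1≡k → NP.<-irrefl (P.sym s+1≡k) (NP.m≤n⇒m≤1+n k<s))))
                 (Tset-positions (suc k) bs)
  head : not (mem (suc k) (k ∷ S)) ≡ notHead bs
  head = P.trans (P.cong (λ b → not (b ∨ mem (suc k) S)) (==-≢ λ k+1≡k → NP.<-irrefl (P.sym k+1≡k) NP.≤-refl))
                 (P.trans (P.cong not (mem-positions-head (suc k) bs)) (BP.not-involutive (notHead bs)))
  goal : Tset (k ∷ S) ≡ positions k ((true ∧ notHead bs) ∷ runEnds bs)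
  goal with notHead bs | head
  ... | true  | h rewrite h = P.cong (k ∷_) rest
  ... | false | h rewrite h = rest

Sparse : List ℕ → Set
Sparse []      = ⊤
Sparse (t ∷ T) = All (λ u → suc (suc t) ≤ u) T × Sparse T

runEnds-sparse : ∀ k bs → Sparse (positions k (runEnds bs))
runEnds-sparse k []                  = tt
runEnds-sparse k (false ∷ bs)        = runEnds-sparse (suc k) bs
runEnds-sparse k (true ∷ [])         = [] , tt
runEnds-sparse k (true ∷ true ∷ bs)  = runEnds-sparse (suc k) (true ∷ bs)
runEnds-sparse k (true ∷ false ∷ bs) = positions-≥ (suc (suc k)) (runEnds bs) , runEnds-sparse (suc (suc k)) bs

range-∷ : ∀ lo L → lo < L → range lo L ≡ lo ∷ range (suc lo) L
range-∷ lo L lo<L rewrite NP.+-∸-assoc 1 lo<L = P.cong₂ _∷_ (NP.+-identityʳ lo) (begin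
  map (lo N.+_) (applyUpTo suc (L ∸ suc lo))     ≡⟨ LP.map-applyUpTo suc _ (L ∸ suc lo) ⟩
  applyUpTo (λ i → lo N.+ suc i) (L ∸ suc lo)   ≡⟨ applyUpTo-cong (L ∸ suc lo) (NP.+-suc lo) ⟩
  applyUpTo (suc lo N.+_) (L ∸ suc lo)          ≡⟨ LP.map-applyUpTo id _ (L ∸ suc lo) ⟨
  map (suc lo N.+_) (upTo (L ∸ suc lo))         ∎)
  where open P.≡-Reasoning

range-≥ : ∀ lo L → All (lo ≤_) (range lo L)
range-≥ lo L = AllP.map⁺ (AllP.applyUpTo⁺₂ id (L ∸ lo) (NP.m≤m+n lo))

bfilter-range-insert : ∀ (b b′ : ℕ → Bool) t L d lo → t ≡ lo N.+ d → t < L →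
  (∀ k → b′ k ≡ (k == t) ∨ b k) → (∀ k → k ≤ t → b k ≡ false) →
  bfilter b′ (range lo L) ≡ t ∷ bfilter b (range lo L)
bfilter-range-insert b b′ t L zero lo t≡lo+0 t<L b′≡ b≡false
  rewrite NP.+-identityʳ lo | t≡lo+0 | range-∷ lo L t<L | b′≡ lo | b≡false lo NP.≤-refl | ==-refl lo =
  P.cong (lo ∷_) (bfilter-congᴬ b′ b (range-≥ (suc lo) L)
    (λ k lo<k → P.trans (b′≡ k) (P.cong (_∨ b k) (==-≢ λ k≡lo → NP.<-irrefl (P.sym k≡lo) lo<k))))
bfilter-range-insert b b′ t L (suc d) lo t≡ t<L b′≡ b≡false
  rewrite range-∷ lo L (NP.≤-trans (P.subst (suc lo ≤_) (P.sym (P.trans t≡ (NP.+-suc lo d))) (s≤s (NP.m≤m+n lo d))) (NP.<⇒≤ t<L))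
        | b′≡ lo | b≡false lo (P.subst (lo ≤_) (P.sym t≡) (NP.m≤m+n lo (suc d)))
        | ==-≢ {lo} {t} (λ lo≡t → NP.<-irrefl (P.trans lo≡t (P.trans t≡ (NP.+-suc lo d))) (s≤s (NP.m≤m+n lo d))) =
  bfilter-range-insert b b′ t L d (suc lo) (P.trans t≡ (NP.+-suc lo d)) t<L b′≡ b≡false

inK : List ℕ → List ℕ → ℕ → Bool
inK I J k = mem k I ∨ mem k J ∨ mem (suc k) J

inK-below : ∀ t I J → All (suc (suc t) ≤_) I → All (suc (suc t) ≤_) J → ∀ k → k ≤ t → inK I J k ≡ false
inK-below t I J t+2≤I t+2≤J k k≤t = P.cong₂ _∨_ (mem-< k I (All.map k<u t+2≤I))
  (P.cong₂ _∨_ (mem-< k J (All.map k<u t+2≤J)) (mem-< (suc k) J (All.map (NP.≤-trans (s≤s (s≤s k≤t))) t+2≤J)))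
  where
  k<u : ∀ {u} → suc (suc t) ≤ u → k < u
  k<u t+2≤u = NP.≤-trans (s≤s k≤t) (NP.<⇒≤ t+2≤u)

downIJ-∷ˡ : ∀ γ t I J → 1 ≤ t → t < length γ → All (suc (suc t) ≤_) I → All (suc (suc t) ≤_) J →
            downIJ γ (t ∷ I) J ≡ down1 t (downIJ γ I J)
downIJ-∷ˡ γ t I J 1≤t t<|γ| t+2≤I t+2≤J = P.cong (λ K → downK K γ)
  (bfilter-range-insert (inK I J) (inK (t ∷ I) J) t (length γ) (t ∸ 1) 1 (P.sym (NP.m+[n∸m]≡n 1≤t)) t<|γ|
    (λ k → BP.∨-assoc (k == t) (mem k I) _) (inK-below t I J t+2≤I t+2≤J))

downIJ-∷ʳ : ∀ γ t I J → 2 ≤ t → t < length γ → All (suc (suc t) ≤_) I → All (suc (suc t) ≤_) J →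
            downIJ γ I (t ∷ J) ≡ down1 (t ∸ 1) (down1 t (downIJ γ I J))
downIJ-∷ʳ γ (suc (suc t′)) I J (s≤s (s≤s z≤n)) t<|γ| t+2≤I t+2≤J = P.cong (λ K → downK K γ)
  (P.trans (bfilter-range-insert inKt (inK I (t ∷ J)) (suc t′) (length γ) t′ 1 P.refl (NP.<-trans (NP.n<1+n _) t<|γ|) rearrange inKt-below)
           (P.cong (suc t′ ∷_) (bfilter-range-insert (inK I J) inKt t (length γ) (suc t′) 1 P.refl t<|γ| (λ _ → P.refl)
                                                       (inK-below t I J t+2≤I t+2≤J))))
  where
  t = suc (suc t′)
  inKt : ℕ → Bool
  inKt k = (k == t) ∨ inK I J k
  rearrange : ∀ k → inK I (t ∷ J) k ≡ (k == suc t′) ∨ inKt k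
  rearrange k = P.trans (∨-rearrange (mem k I) (k == t) (mem k J) (suc k == t) (mem (suc k) J))
                        (P.cong (_∨ inKt k) (==-suc k (suc t′)))
    where
    open CMSolver BP.∨-commutativeMonoid
    ∨-rearrange : ∀ a b c d e → (a ∨ ((b ∨ c) ∨ (d ∨ e))) ≡ (d ∨ (b ∨ (a ∨ (c ∨ e))))
    ∨-rearrange = solve 5 (λ a b c d e → a ⊕ ((b ⊕ c) ⊕ (d ⊕ e)) ⊜ d ⊕ (b ⊕ (a ⊕ (c ⊕ e)))) P.refl
  inKt-below : ∀ k → k ≤ suc t′ → inKt k ≡ false
  inKt-below k k≤t-1 = P.cong₂ _∨_ (==-≢ λ k≡t → NP.<-irrefl k≡t (s≤s k≤t-1))
                              (inK-below t I J t+2≤I t+2≤J k (NP.m≤n⇒m≤1+n k≤t-1))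

bfilter-false : ∀ {A : Set} (xs : List A) → bfilter (λ _ → false) xs ≡ []
bfilter-false []       = P.refl
bfilter-false (x ∷ xs) = bfilter-false xs

bfilter-All : ∀ {A : Set} {P : A → Set} (f : A → Bool) {xs} → All P xs → All P (bfilter f xs)
bfilter-All f []                   = []
bfilter-All f {x ∷ xs} (px ∷ pxs) with f x
... | true  = px ∷ bfilter-All f pxs
... | false = bfilter-All f pxs

subs-All : ∀ {P : ℕ → Set} {xs} → All P xs → All (All P) (subs xs)
subs-All []         = [] ∷ []
subs-All (px ∷ pxs) = AllP.++⁺ (subs-All pxs) (AllP.map⁺ (All.map (px ∷_) (subs-All pxs)))

without-∈ : ∀ Rm t T → mem t Rm ≡ true → without Rm (t ∷ T) ≡ without Rm T
without-∈ Rm t T t∈Rm rewrite t∈Rm = P.refl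

without-∉ : ∀ Rm t T → mem t Rm ≡ false → without Rm (t ∷ T) ≡ t ∷ without Rm T
without-∉ Rm t T t∉Rm rewrite t∉Rm = P.refl

disjoint-∷ʳ : ∀ t I J → All (suc (suc t) ≤_) I → disjoint I (t ∷ J) ≡ disjoint I J
disjoint-∷ʳ t []      J []              = P.refl
disjoint-∷ʳ t (i ∷ I) J (t+2≤i ∷ t+2≤I) = P.cong₂ (λ b c → not b ∧ c)
  (P.cong (_∨ mem i J) (==-≢ λ i≡t → NP.<-irrefl (P.sym i≡t) (NP.<⇒≤ t+2≤i))) (disjoint-∷ʳ t I J t+2≤I)

disjoint-∷ˡ : ∀ t I J → All (suc (suc t) ≤_) J → disjoint (t ∷ I) J ≡ disjoint I J
disjoint-∷ˡ t I J t+2≤J = P.cong (λ b → not b ∧ disjoint I J) (mem-< t J (All.map NP.<⇒≤ t+2≤J))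

disjoint-∷-∷ : ∀ t I J → disjoint (t ∷ I) (t ∷ J) ≡ false
disjoint-∷-∷ t I J = P.cong (λ b → not (b ∨ mem t J) ∧ disjoint I (t ∷ J)) (==-refl t)

down1-[] : ∀ t → down1 t [] ≡ []
down1-[] zero          = P.refl
down1-[] (suc zero)    = P.refl
down1-[] (suc (suc t)) = P.refl

take-down1-< : ∀ t r δ → r < t → take r (down1 t δ) ≡ take r δ
take-down1-< t             zero    δ       r<t       = P.refl
take-down1-< (suc (suc t)) (suc r) []      r<t       = P.refl
take-down1-< (suc (suc t)) (suc r) (a ∷ δ) (s≤s r<t) = P.cong (a ∷_) (take-down1-< (suc t) r δ r<t)
take-down1-< (suc zero)    (suc r) δ       (s≤s ())

drop-down1-< : ∀ t r δ → r < t → drop r (down1 t δ) ≡ down1 (t ∸ r) (drop r δ)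
drop-down1-< t             zero    δ       r<t       = P.refl
drop-down1-< (suc (suc t)) (suc r) []      r<t       = P.sym (down1-[] (suc t ∸ r))
drop-down1-< (suc (suc t)) (suc r) (a ∷ δ) (s≤s r<t) = drop-down1-< (suc t) r δ r<t
drop-down1-< (suc zero)    (suc r) δ       (s≤s ())

take-down1-≥ : ∀ t i δ → 1 ≤ t → take (t N.+ i) (down1 t δ) ≡ down1 t (take (suc (t N.+ i)) δ)
take-down1-≥ (suc zero)    i []          _ = P.refl
take-down1-≥ (suc zero)    i (a ∷ [])    _ = P.cong (a ∷_) (P.trans (LP.take-[] i) (P.sym (LP.take-[] (suc i))))
take-down1-≥ (suc zero)    i (a ∷ b ∷ δ) _ = P.refl
take-down1-≥ (suc (suc t)) i []          _ = P.refl
take-down1-≥ (suc (suc t)) i (a ∷ δ)     _ = P.cong (a ∷_) (take-down1-≥ (suc t) i δ (s≤s z≤n))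

drop-down1-≥ : ∀ t i δ → 1 ≤ t → drop (t N.+ i) (down1 t δ) ≡ drop (suc (t N.+ i)) δ
drop-down1-≥ (suc zero)    i []          _ = P.refl
drop-down1-≥ (suc zero)    i (a ∷ [])    _ = P.trans (LP.drop-[] i) (P.sym (LP.drop-[] (suc i)))
drop-down1-≥ (suc zero)    i (a ∷ b ∷ δ) _ = P.refl
drop-down1-≥ (suc (suc t)) i []          _ = P.refl
drop-down1-≥ (suc (suc t)) i (a ∷ δ)     _ = drop-down1-≥ (suc t) i δ (s≤s z≤n)

length-down1-≤ : ∀ t δ → length (down1 t δ) ≤ length δ
length-down1-≤ zero          δ           = NP.≤-refl
length-down1-≤ (suc zero)    []          = NP.≤-refl
length-down1-≤ (suc zero)    (a ∷ [])    = NP.≤-refl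
length-down1-≤ (suc zero)    (a ∷ b ∷ δ) = s≤s (NP.n≤1+n _)
length-down1-≤ (suc (suc t)) []          = NP.≤-refl
length-down1-≤ (suc (suc t)) (a ∷ δ)     = s≤s (length-down1-≤ (suc t) δ)

length-down1-> : ∀ t δ m → m < t → m < length δ → m < length (down1 t δ)
length-down1-> (suc zero)    (a ∷ [])    zero    _         m<|δ|       = m<|δ|
length-down1-> (suc zero)    (a ∷ b ∷ δ) zero    _         _           = s≤s z≤n
length-down1-> (suc zero)    δ           (suc m) (s≤s ())  _
length-down1-> (suc (suc t)) (a ∷ δ)     zero    _         _           = s≤s z≤n
length-down1-> (suc (suc t)) (a ∷ δ)     (suc m) (s≤s m<t) (s≤s m<|δ|) = s≤s (length-down1-> (suc t) δ m m<t m<|δ|)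

length-down1 : ∀ t δ → 1 ≤ t → t < length δ → suc (length (down1 t δ)) ≡ length δ
length-down1 (suc zero)    (a ∷ b ∷ δ) _ _          = P.refl
length-down1 (suc zero)    (a ∷ [])    _ (s≤s ())
length-down1 (suc (suc t)) (a ∷ δ)     _ (s≤s t<|δ|) = P.cong suc (length-down1 (suc t) δ (s≤s z≤n) t<|δ|)

sum-down1 : ∀ t δ → sum (down1 t δ) ≡ sum δ
sum-down1 zero          δ           = P.refl
sum-down1 (suc zero)    []          = P.refl
sum-down1 (suc zero)    (a ∷ [])    = P.refl
sum-down1 (suc zero)    (a ∷ b ∷ δ) = NP.+-assoc a b (sum δ)
sum-down1 (suc (suc t)) []          = P.refl
sum-down1 (suc (suc t)) (a ∷ δ)     = P.cong (a N.+_) (sum-down1 (suc t) δ)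

null-down1 : ∀ t δ → null (down1 t δ) ≡ null δ
null-down1 zero          δ           = P.refl
null-down1 (suc zero)    []          = P.refl
null-down1 (suc zero)    (a ∷ [])    = P.refl
null-down1 (suc zero)    (a ∷ b ∷ δ) = P.refl
null-down1 (suc (suc t)) []          = P.refl
null-down1 (suc (suc t)) (a ∷ δ)     = P.refl

length-take-≤ : ∀ {A : Set} r (xs : List A) → r ≤ length xs → length (take r xs) ≡ r
length-take-≤ r xs r≤|xs| = P.trans (LP.length-take r xs) (NP.m≤n⇒m⊓n≡m r≤|xs|)

==-∸ : ∀ t N r → r ≤ t → r ≤ N → ((t ∸ r) == (N ∸ r)) ≡ (t == N)
==-∸ t       N       zero    _         _         = P.refl
==-∸ (suc t) (suc N) (suc r) (s≤s r≤t) (s≤s r≤N) = P.trans (==-∸ t N r r≤t r≤N) (P.sym (==-suc t N))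

<ᵇ-true : ∀ {m n} → m < n → (m <ᵇ n) ≡ true
<ᵇ-true {zero}  {suc n} _         = P.refl
<ᵇ-true {suc m} {suc n} (s≤s m<n) = <ᵇ-true m<n

<ᵇ-false : ∀ {m n} → n ≤ m → (m <ᵇ n) ≡ false
<ᵇ-false {m}     {zero}  _         = P.refl
<ᵇ-false {suc m} {suc n} (s≤s n≤m) = <ᵇ-false n≤m

≤ᵇ-true : ∀ {m n} → m ≤ n → (m ≤ᵇ n) ≡ true
≤ᵇ-true {zero}  _         = P.refl
≤ᵇ-true {suc m} (s≤s m≤n) = <ᵇ-true (s≤s m≤n)

≤ᵇ-false : ∀ {m n} → n < m → (m ≤ᵇ n) ≡ false
≤ᵇ-false {suc m} {zero}  _         = P.refl
≤ᵇ-false {suc m} {suc n} (s≤s n<m) = <ᵇ-false n<m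

beforeCut : ℕ → List ℕ → List ℕ
beforeCut r T = bfilter (λ u → u ≤ᵇ r) T

afterCut : ℕ → List ℕ → List ℕ
afterCut r T = map (_∸ r) (bfilter (λ u → r <ᵇ u) T)

beforeCut-[] : ∀ r T → All (r <_) T → beforeCut r T ≡ []
beforeCut-[] r []      []            = P.refl
beforeCut-[] r (t ∷ T) (r<t ∷ r<T) rewrite ≤ᵇ-false r<t = beforeCut-[] r T r<T

beforeCut-∷-≤ : ∀ r t T → t ≤ r → beforeCut r (t ∷ T) ≡ t ∷ beforeCut r T
beforeCut-∷-≤ r t T t≤r rewrite ≤ᵇ-true t≤r = P.refl

beforeCut-∷-> : ∀ r t T → r < t → beforeCut r (t ∷ T) ≡ beforeCut r T
beforeCut-∷-> r t T r<t rewrite ≤ᵇ-false r<t = P.refl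

afterCut-∷-> : ∀ r t T → r < t → afterCut r (t ∷ T) ≡ (t ∸ r) ∷ afterCut r T
afterCut-∷-> r t T r<t rewrite <ᵇ-true r<t = P.refl

afterCut-∷-≤ : ∀ r t T → t ≤ r → afterCut r (t ∷ T) ≡ afterCut r T
afterCut-∷-≤ r t T t≤r rewrite <ᵇ-false t≤r = P.refl

bfilter-true : ∀ {A : Set} {P : A → Set} (f : A → Bool) {xs : List A} → All P xs → (∀ x → P x → f x ≡ true) → bfilter f xs ≡ xs
bfilter-true f []         _ = P.refl
bfilter-true f {x ∷ xs} (px ∷ pxs) f≡true rewrite f≡true x px = P.cong (x ∷_) (bfilter-true f pxs f≡true)

beforeCut-positions : ∀ j r bs → beforeCut (j N.+ r) (positions (suc j) bs) ≡ positions (suc j) (take r bs)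
beforeCut-positions j zero bs rewrite NP.+-identityʳ j = beforeCut-[] j (positions (suc j) bs) (positions-≥ (suc j) bs)
beforeCut-positions j (suc r) [] = P.refl
beforeCut-positions j (suc r) (true ∷ bs)
  rewrite ≤ᵇ-true {suc j} {j N.+ suc r} (P.subst (suc j ≤_) (P.sym (NP.+-suc j r)) (s≤s (NP.m≤m+n j r))) | NP.+-suc j r =
  P.cong (suc j ∷_) (beforeCut-positions (suc j) r bs)
beforeCut-positions j (suc r) (false ∷ bs) rewrite NP.+-suc j r = beforeCut-positions (suc j) r bs

map-∸-positions : ∀ j k bs → map (_∸ j) (positions (j N.+ k) bs) ≡ positions k bs
map-∸-positions j k []           = P.refl
map-∸-positions j k (true ∷ bs)  rewrite P.sym (NP.+-suc j k) = P.cong₂ _∷_ (NP.m+n∸m≡n j k) (map-∸-positions j (suc k) bs)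
map-∸-positions j k (false ∷ bs) rewrite P.sym (NP.+-suc j k) = map-∸-positions j (suc k) bs

afterCut-positions : ∀ j r bs → afterCut (j N.+ r) (positions (suc j) bs) ≡ positions 1 (drop r bs)
afterCut-positions j zero bs rewrite NP.+-identityʳ j =
  P.trans (P.cong (map (_∸ j)) (bfilter-true (λ u → j <ᵇ u) (positions-≥ (suc j) bs) (λ _ → <ᵇ-true)))
          (P.trans (P.cong (λ k → map (_∸ j) (positions k bs)) (NP.+-comm 1 j)) (map-∸-positions j 1 bs))
afterCut-positions j (suc r) [] = P.refl
afterCut-positions j (suc r) (true ∷ bs)
  rewrite <ᵇ-false {j N.+ suc r} {suc j} (P.subst (suc j ≤_) (P.sym (NP.+-suc j r)) (s≤s (NP.m≤m+n j r))) | NP.+-suc j r =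
  afterCut-positions (suc j) r bs
afterCut-positions j (suc r) (false ∷ bs) rewrite NP.+-suc j r = afterCut-positions (suc j) r bs

drop-runEnds : ∀ r bs → drop r (runEnds bs) ≡ runEnds (drop r bs)
drop-runEnds zero    bs       = P.refl
drop-runEnds (suc r) []       = P.refl
drop-runEnds (suc r) (b ∷ bs) = drop-runEnds r bs

runEndPositions : Word → List ℕ
runEndPositions w = positions 1 (runEnds (flags w))

runEndPositions-≤ : ∀ w → All (_≤ length w) (runEndPositions w)
runEndPositions-≤ w = All.map (λ {t} t<1+|w| → NP.≤-pred (P.subst (t <_) |runEnds| t<1+|w|)) (positions-< 1 (runEnds (flags w)))
  where
  |runEnds| : suc (length (runEnds (flags w))) ≡ suc (length w)
  |runEnds| = P.cong suc (P.trans (length-runEnds (flags w)) (LP.length-map proj₂ w))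

beforeCut-runEndPositions : ∀ r w → beforeCut r (runEndPositions w) ≡ positions 1 (take r (runEnds (flags w)))
beforeCut-runEndPositions r w = beforeCut-positions 0 r (runEnds (flags w))

afterCut-runEndPositions : ∀ r w → afterCut r (runEndPositions w) ≡ runEndPositions (drop r w)
afterCut-runEndPositions r w = P.trans (afterCut-positions 0 r (runEnds (flags w)))
  (P.cong (positions 1) (P.trans (drop-runEnds r (flags w)) (P.cong runEnds (LP.drop-map r w))))
module _ {c ℓ} (R : CommutativeRing c ℓ) (q : CommutativeRing.Carrier R) where

  open Enriched R q
  open CommutativeRing R
  open import Relation.Binary.Reasoning.Setoid setoid
  open CMSolver +-commutativeMonoid using (solve; _⊕_; _⊜_)
  open CommSemigroupProperties +-commutativeSemigroup using () renaming (interchange to +-interchange)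
  open CommSemigroupProperties *-commutativeSemigroup using () renaming (interchange to *-interchange)

  opaque
    ∑ : {A : Set} → (A → Carrier) → List A → Carrier
    ∑ f xs = rsum (map f xs)

    ∑< : ℕ → (ℕ → Carrier) → Carrier
    ∑< zero    f = 0#
    ∑< (suc n) f = f 0 + ∑< n (f ∘ suc)

    rsum-map : {A : Set} (f : A → Carrier) (xs : List A) → rsum (map f xs) ≡ ∑ f xs
    rsum-map f xs = P.refl

    ∑-++ : {A : Set} (f : A → Carrier) (xs ys : List A) → ∑ f (xs ++ ys) ≈ ∑ f xs + ∑ f ys
    ∑-++ f []       ys = sym (+-identityˡ _)
    ∑-++ f (x ∷ xs) ys = trans (+-congˡ (∑-++ f xs ys)) (sym (+-assoc _ _ _))

    ∑-[-] : {A : Set} (f : A → Carrier) (x : A) → ∑ f (x ∷ []) ≈ f x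
    ∑-[-] f x = +-identityʳ (f x)

    ∑-map : {A B : Set} (f : B → Carrier) (g : A → B) (xs : List A) → ∑ f (map g xs) ≡ ∑ (f ∘ g) xs
    ∑-map f g xs = P.cong rsum (P.sym (LP.map-∘ xs))

    ∑-cong : {A : Set} {f g : A → Carrier} → (∀ x → f x ≈ g x) → ∀ xs → ∑ f xs ≈ ∑ g xs
    ∑-cong f≈g []       = refl
    ∑-cong f≈g (x ∷ xs) = +-cong (f≈g x) (∑-cong f≈g xs)

    ∑-congᴬ : {A : Set} {P : A → Set} {f g : A → Carrier} → (∀ x → P x → f x ≈ g x) → ∀ {xs} → All P xs → ∑ f xs ≈ ∑ g xs
    ∑-congᴬ f≈g []         = refl
    ∑-congᴬ f≈g (px ∷ pxs) = +-cong (f≈g _ px) (∑-congᴬ f≈g pxs)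

    ∑-0 : {A : Set} (xs : List A) → ∑ (λ _ → 0#) xs ≈ 0#
    ∑-0 []       = refl
    ∑-0 (x ∷ xs) = trans (+-identityˡ _) (∑-0 xs)

    ∑-+ : {A : Set} (f g : A → Carrier) (xs : List A) → ∑ (λ x → f x + g x) xs ≈ ∑ f xs + ∑ g xs
    ∑-+ f g []       = sym (+-identityˡ _)
    ∑-+ f g (x ∷ xs) = trans (+-congˡ (∑-+ f g xs)) (+-interchange _ _ _ _)

    ∑-*ˡ : {A : Set} (a : Carrier) (f : A → Carrier) (xs : List A) → a * ∑ f xs ≈ ∑ (λ x → a * f x) xs
    ∑-*ˡ a f []       = zeroʳ a
    ∑-*ˡ a f (x ∷ xs) = trans (distribˡ a _ _) (+-congˡ (∑-*ˡ a f xs))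

    ∑-*ʳ : {A : Set} (a : Carrier) (f : A → Carrier) (xs : List A) → ∑ f xs * a ≈ ∑ (λ x → f x * a) xs
    ∑-*ʳ a f []       = zeroˡ a
    ∑-*ʳ a f (x ∷ xs) = trans (distribʳ a _ _) (+-congˡ (∑-*ʳ a f xs))

    ∑-concatMap : {A B : Set} (f : B → Carrier) (g : A → List B) (xs : List A) →
                  ∑ f (concatMap g xs) ≈ ∑ (λ x → ∑ f (g x)) xs
    ∑-concatMap f g []       = refl
    ∑-concatMap f g (x ∷ xs) = trans (∑-++ f (g x) (concatMap g xs)) (+-congˡ (∑-concatMap f g xs))

    ∑<-suc : ∀ n (f : ℕ → Carrier) → ∑< (suc n) f ≈ f 0 + ∑< n (f ∘ suc)
    ∑<-suc n f = refl

    ∑-applyUpTo : ∀ (f : ℕ → Carrier) n → rsum (applyUpTo f n) ≡ ∑< n f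
    ∑-applyUpTo f zero    = P.refl
    ∑-applyUpTo f (suc n) = P.cong (f 0 +_) (∑-applyUpTo (f ∘ suc) n)

    ∑-upTo : ∀ (f : ℕ → Carrier) n → ∑ f (upTo n) ≡ ∑< n f
    ∑-upTo f n = P.trans (P.cong rsum (LP.map-upTo f n)) (∑-applyUpTo f n)

    ∑<-cong : ∀ n {f g : ℕ → Carrier} → (∀ i → i < n → f i ≈ g i) → ∑< n f ≈ ∑< n g
    ∑<-cong zero    f≈g = refl
    ∑<-cong (suc n) f≈g = +-cong (f≈g 0 (s≤s z≤n)) (∑<-cong n (λ i i<n → f≈g (suc i) (s≤s i<n)))

    ∑<-cong-≡ : ∀ n {f g : ℕ → Carrier} → (∀ i → i < n → f i ≡ g i) → ∑< n f ≈ ∑< n g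
    ∑<-cong-≡ n f≡g = ∑<-cong n (λ i i<n → reflexive (f≡g i i<n))

    ∑<-0 : ∀ n → ∑< n (λ _ → 0#) ≈ 0#
    ∑<-0 zero    = refl
    ∑<-0 (suc n) = trans (+-identityˡ _) (∑<-0 n)

    ∑<-1 : ∀ (f : ℕ → Carrier) → ∑< 1 f ≈ f 0
    ∑<-1 f = +-identityʳ (f 0)

    ∑<-+ : ∀ n (f g : ℕ → Carrier) → ∑< n (λ i → f i + g i) ≈ ∑< n f + ∑< n g
    ∑<-+ zero    f g = sym (+-identityˡ _)
    ∑<-+ (suc n) f g = trans (+-congˡ (∑<-+ n (f ∘ suc) (g ∘ suc))) (+-interchange _ _ _ _)

    ∑<-*ˡ : ∀ n a (f : ℕ → Carrier) → a * ∑< n f ≈ ∑< n (λ i → a * f i)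
    ∑<-*ˡ zero    a f = zeroʳ a
    ∑<-*ˡ (suc n) a f = trans (distribˡ a _ _) (+-congˡ (∑<-*ˡ n a (f ∘ suc)))

    ∑<-*ʳ : ∀ n a (f : ℕ → Carrier) → ∑< n f * a ≈ ∑< n (λ i → f i * a)
    ∑<-*ʳ zero    a f = zeroˡ a
    ∑<-*ʳ (suc n) a f = trans (distribʳ a _ _) (+-congˡ (∑<-*ʳ n a (f ∘ suc)))

    ∑<-split : ∀ m n (f : ℕ → Carrier) → ∑< (m N.+ n) f ≈ ∑< m f + ∑< n (λ i → f (m N.+ i))
    ∑<-split zero    n f = sym (+-identityˡ _)
    ∑<-split (suc m) n f = trans (+-congˡ (∑<-split m n (f ∘ suc))) (sym (+-assoc _ _ _))

    ∑<-*-∑< : ∀ m n (f g : ℕ → Carrier) → ∑< m f * ∑< n g ≈ ∑< m (λ i → ∑< n (λ j → f i * g j))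
    ∑<-*-∑< m n f g = trans (∑<-*ʳ m (∑< n g) f) (∑<-cong m (λ i _ → ∑<-*ˡ n (f i) g))

    ∑<-comm : ∀ m n (f : ℕ → ℕ → Carrier) → ∑< m (λ i → ∑< n (f i)) ≈ ∑< n (λ j → ∑< m (λ i → f i j))
    ∑<-comm zero    n f = sym (∑<-0 n)
    ∑<-comm (suc m) n f = trans (+-congˡ (∑<-comm m n (f ∘ suc))) (sym (∑<-+ n (f 0) _))

    ∑-∑<-comm : {A : Set} (n : ℕ) (f : A → ℕ → Carrier) (xs : List A) → ∑ (λ x → ∑< n (f x)) xs ≈ ∑< n (λ i → ∑ (λ x → f x i) xs)
    ∑-∑<-comm zero    f xs = ∑-0 xs
    ∑-∑<-comm (suc n) f xs = trans (∑-+ (λ x → f x 0) (λ x → ∑< n (f x ∘ suc)) xs) (+-congˡ (∑-∑<-comm n (λ x i → f x (suc i)) xs))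

  cond : Bool → Carrier → Carrier
  cond b x = if b then x else 0#

  cond-cong : ∀ b {x y} → x ≈ y → cond b x ≈ cond b y
  cond-cong true  x≈y = x≈y
  cond-cong false x≈y = refl

  cond-+ : ∀ b x y → cond b (x + y) ≈ cond b x + cond b y
  cond-+ true  x y = refl
  cond-+ false x y = sym (+-identityˡ 0#)

  cond-*ˡ : ∀ b a x → cond b (a * x) ≈ a * cond b x
  cond-*ˡ true  a x = refl
  cond-*ˡ false a x = sym (zeroʳ a)

  cond-*ʳ : ∀ b a x → cond b (a * x) ≈ cond b a * x
  cond-*ʳ true  a x = refl
  cond-*ʳ false a x = sym (zeroˡ x)

  cond-∧ : ∀ b₁ b₂ x y → cond b₁ x * cond b₂ y ≈ cond (b₁ ∧ b₂) (x * y)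
  cond-∧ true  true  x y = refl
  cond-∧ true  false x y = zeroʳ x
  cond-∧ false b₂    x y = zeroˡ _

  ∑-cond : {A : Set} (b : Bool) (f : A → Carrier) (xs : List A) → ∑ (λ x → cond b (f x)) xs ≈ cond b (∑ f xs)
  ∑-cond true  f xs = refl
  ∑-cond false f xs = ∑-0 xs

  ∑<-cond : ∀ n b (f : ℕ → Carrier) → ∑< n (λ i → cond b (f i)) ≈ cond b (∑< n f)
  ∑<-cond n true  f = refl
  ∑<-cond n false f = ∑<-0 n

  ∑<-around : ∀ t k (g : ℕ → Carrier) → ∑< (suc (t N.+ suc k)) g ≈ ∑< t g + (g t + ∑< (suc k) (λ i → g (suc (t N.+ i))))
  ∑<-around t k g = begin
    ∑< (suc (t N.+ suc k)) g                     ≡⟨ P.cong (λ n → ∑< n g) (NP.+-suc t (suc k)) ⟨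
    ∑< (t N.+ suc (suc k)) g                     ≈⟨ ∑<-split t (suc (suc k)) g ⟩
    ∑< t g + ∑< (suc (suc k)) (λ j → g (t N.+ j)) ≈⟨ +-congˡ (∑<-suc (suc k) _) ⟩
    ∑< t g + (g (t N.+ 0) + ∑< (suc k) (λ i → g (t N.+ suc i)))
      ≈⟨ +-congˡ (+-cong (reflexive (P.cong g (NP.+-identityʳ t))) (∑<-cong-≡ (suc k) (λ i _ → P.cong g (NP.+-suc t i)))) ⟩
    ∑< t g + (g t + ∑< (suc k) (λ i → g (suc (t N.+ i)))) ∎

  ∑<-cond-* : ∀ n b a (f : ℕ → Carrier) → ∑< n (λ i → cond b (a * f i)) ≈ cond b (a * ∑< n f)
  ∑<-cond-* n b a f = trans (∑<-cond n b (λ i → a * f i)) (cond-cong b (sym (∑<-*ˡ n a f)))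

  ∑-linear : {A : Set} (f g k : A → Carrier) (a b : Carrier) (xs : List A) →
    ∑ (λ x → f x + (a * g x + b * k x)) xs ≈ ∑ f xs + (a * ∑ g xs + b * ∑ k xs)
  ∑-linear f g k a b xs = begin
    ∑ (λ x → f x + (a * g x + b * k x)) xs                ≈⟨ ∑-+ f _ xs ⟩
    ∑ f xs + ∑ (λ x → a * g x + b * k x) xs               ≈⟨ +-congˡ (∑-+ _ _ xs) ⟩
    ∑ f xs + (∑ (λ x → a * g x) xs + ∑ (λ x → b * k x) xs) ≈⟨ +-congˡ (+-cong (∑-*ˡ a g xs) (∑-*ˡ b k xs)) ⟨
    ∑ f xs + (a * ∑ g xs + b * ∑ k xs)                    ∎

  ∑∑-scale : ∀ {P : ℕ → Set} (f g : List ℕ → List ℕ → Carrier) a {Is Js} →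
             (∀ I J → All P I → All P J → f I J ≈ a * g I J) → All (All P) Is → All (All P) Js →
             ∑ (λ I → ∑ (f I) Js) Is ≈ a * ∑ (λ I → ∑ (g I) Js) Is
  ∑∑-scale f g a {Is} {Js} f≈ag PIs PJs =
    trans (∑-congᴬ (λ I PI → trans (∑-congᴬ (λ J PJ → f≈ag I J PI PJ) PJs) (sym (∑-*ˡ a (g I) Js))) PIs) (sym (∑-*ˡ a _ Is))

  -- The recursion of η in the first variable

  weight : ℕ → Carrier
  weight zero    = 1#
  weight (suc _) = q + 1#

  pow-sgn : ∀ p d → pow (q + 1#) (sgn p N.+ d) ≈ weight p * pow (q + 1#) d
  pow-sgn zero    d = sym (*-identityˡ _)
  pow-sgn (suc p) d = refl

  ∑-wseq-suc : ∀ k m lo (f : List ℕ → Carrier) → ∑ f (wseq (suc k) m (suc lo)) ≈ ∑ (f ∘ map suc) (wseq k m lo)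
  ∑-wseq-suc k zero    lo f = reflexive (∑-map f (map suc) ([] ∷ []))
  ∑-wseq-suc k (suc m) lo f = begin
    ∑ f (concatMap (λ i → map (i ∷_) (wseq (suc k) m i)) (range (suc lo) (suc k)))
      ≈⟨ ∑-concatMap f _ (range (suc lo) (suc k)) ⟩
    ∑ (λ i → ∑ f (map (i ∷_) (wseq (suc k) m i))) (range (suc lo) (suc k))
      ≡⟨ P.cong (∑ (λ i → ∑ f (map (i ∷_) (wseq (suc k) m i)))) (range-suc lo k) ⟩
    ∑ (λ i → ∑ f (map (i ∷_) (wseq (suc k) m i))) (map suc (range lo k))
      ≡⟨ ∑-map _ suc (range lo k) ⟩
    ∑ (λ i → ∑ f (map (suc i ∷_) (wseq (suc k) m (suc i)))) (range lo k)
      ≈⟨ ∑-cong (λ i → trans (reflexive (∑-map f (suc i ∷_) (wseq (suc k) m (suc i)))) (∑-wseq-suc k m i (f ∘ (suc i ∷_)))) (range lo k) ⟩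
    ∑ (λ i → ∑ (f ∘ (suc i ∷_) ∘ map suc) (wseq k m i)) (range lo k)
      ≈⟨ ∑-cong (λ i → reflexive (P.sym (∑-map (f ∘ map suc) (i ∷_) (wseq k m i)))) (range lo k) ⟩
    ∑ (λ i → ∑ (f ∘ map suc) (map (i ∷_) (wseq k m i))) (range lo k)
      ≈⟨ ∑-concatMap (f ∘ map suc) _ (range lo k) ⟨
    ∑ (f ∘ map suc) (wseq k (suc m) lo) ∎

  ∑-wseq-pad : ∀ k n (f : List ℕ → Carrier) →
               ∑ f (wseq (suc k) n 0) ≈ ∑< (suc n) (λ p → ∑ (f ∘ pad p) (wseq k (n ∸ p) 0))
  ∑-wseq-pad k zero    f = trans (reflexive (∑-map f (pad 0) ([] ∷ []))) (sym (∑<-1 (λ p → ∑ (f ∘ pad p) (wseq k (0 ∸ p) 0))))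
  ∑-wseq-pad k (suc n) f = begin
    ∑ f (concatMap g (range 0 (suc k)))
      ≡⟨ P.cong (λ is → ∑ f (concatMap g is)) (range-0 k) ⟩
    ∑ f (g 0 ++ wseq (suc k) (suc n) 1)
      ≈⟨ ∑-++ f (g 0) _ ⟩
    ∑ f (g 0) + ∑ f (wseq (suc k) (suc n) 1)
      ≈⟨ +-cong (reflexive (∑-map f (0 ∷_) (wseq (suc k) n 0))) (∑-wseq-suc k (suc n) 0 f) ⟩
    ∑ (f ∘ (0 ∷_)) (wseq (suc k) n 0) + ∑ (f ∘ map suc) (wseq k (suc n) 0)
      ≈⟨ +-comm _ _ ⟩
    ∑ (f ∘ map suc) (wseq k (suc n) 0) + ∑ (f ∘ (0 ∷_)) (wseq (suc k) n 0)
      ≈⟨ +-congˡ (∑-wseq-pad k n (f ∘ (0 ∷_))) ⟩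
    _ + ∑< (suc n) (λ p → ∑ (f ∘ pad (suc p)) (wseq k (n ∸ p) 0))
      ≈⟨ ∑<-suc (suc n) (λ p → ∑ (f ∘ pad p) (wseq k (suc n ∸ p) 0)) ⟨
    ∑< (suc (suc n)) (λ p → ∑ (f ∘ pad p) (wseq k (suc n ∸ p) 0)) ∎
    where
    g : ℕ → List (List ℕ)
    g i = map (i ∷_) (wseq (suc k) n i)

  η-∷ : ∀ δ x e → η δ (x ∷ e) ≈ ∑< (suc (length δ)) (λ p → cond (sum (take p δ) == x) (weight p * η (drop p δ) e))
  η-∷ δ x e = trans (reflexive (rsum-map term _)) (trans (∑-wseq-pad k (length δ) term) (∑<-cong (suc (length δ)) (λ p _ → block p)))
    where
    k = length e
    term : List ℕ → Carrier
    term is = if eqList (expo (suc k) is δ) (x ∷ e) then pow (q + 1#) (distinct (suc k) is) else 0#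
    term′ : ℕ → List ℕ → Carrier
    term′ p js = if eqList (expo k js (drop p δ)) e then pow (q + 1#) (distinct k js) else 0#
    term-pad : ∀ p js → term (pad p js) ≈ cond (sum (take p δ) == x) (weight p * term′ p js)
    term-pad p js = trans
      (reflexive (P.cong₂ (λ b d → if b then pow (q + 1#) d else 0#)
        (P.trans (P.cong (λ v → eqList v (x ∷ e)) (expo-pad k p js δ)) (eqList-∷ _ _ x e))
        (distinct-pad k p js)))
      (if-∧ (sum (take p δ) == x) (eqList (expo k js (drop p δ)) e) p (distinct k js))
      where
      if-∧ : ∀ b₁ b₂ p d → (if b₁ ∧ b₂ then pow (q + 1#) (sgn p N.+ d) else 0#) ≈
                           cond b₁ (weight p * (if b₂ then pow (q + 1#) d else 0#))
      if-∧ true  true  p d = pow-sgn p d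
      if-∧ true  false p d = sym (zeroʳ _)
      if-∧ false _     p d = refl
    block : ∀ p → ∑ (term ∘ pad p) (wseq k (length δ ∸ p) 0) ≈ cond (sum (take p δ) == x) (weight p * η (drop p δ) e)
    block p = begin
      ∑ (term ∘ pad p) (wseq k (length δ ∸ p) 0)
        ≈⟨ ∑-cong (term-pad p) (wseq k (length δ ∸ p) 0) ⟩
      ∑ (λ js → cond (sum (take p δ) == x) (weight p * term′ p js)) (wseq k (length δ ∸ p) 0)
        ≈⟨ ∑-cond (sum (take p δ) == x) (λ js → weight p * term′ p js) (wseq k (length δ ∸ p) 0) ⟩
      cond (sum (take p δ) == x) (∑ (λ js → weight p * term′ p js) (wseq k (length δ ∸ p) 0))
        ≈⟨ cond-cong (sum (take p δ) == x) (sym (∑-*ˡ (weight p) (term′ p) (wseq k (length δ ∸ p) 0))) ⟩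
      cond (sum (take p δ) == x) (weight p * ∑ (term′ p) (wseq k (length δ ∸ p) 0))
        ≡⟨ P.cong (λ n → cond (sum (take p δ) == x) (weight p * ∑ (term′ p) (wseq k n 0))) (LP.length-drop p δ) ⟨
      cond (sum (take p δ) == x) (weight p * ∑ (term′ p) (wseq k (length (drop p δ)) 0))
        ≡⟨ P.cong (λ y → cond (sum (take p δ) == x) (weight p * y)) (rsum-map (term′ p) _) ⟨
      cond (sum (take p δ) == x) (weight p * η (drop p δ) e) ∎

  η-[] : ∀ δ → η δ [] ≈ cond (null δ) 1#
  η-[] []      = +-identityʳ 1#
  η-[] (_ ∷ _) = refl

  -- The recursion of the product η α ⊗ η β in the first variable

  ⊗-∑ : ∀ (f g : Series) e → (f ⊗ g) e ≡ ∑ (λ e′ → f e′ * g (zipWith _∸_ e e′)) (boxes e)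
  ⊗-∑ f g e = rsum-map _ (boxes e)

  ⊗-∷ : ∀ (f g : Series) x e →
        (f ⊗ g) (x ∷ e) ≈ ∑< (suc x) (λ b → ∑ (λ e′ → f (b ∷ e′) * g ((x ∸ b) ∷ zipWith _∸_ e e′)) (boxes e))
  ⊗-∷ f g x e = begin
    (f ⊗ g) (x ∷ e)
      ≡⟨ ⊗-∑ f g (x ∷ e) ⟩
    ∑ h (concatMap (λ b → map (b ∷_) (boxes e)) (upTo (suc x)))
      ≈⟨ ∑-concatMap h (λ b → map (b ∷_) (boxes e)) (upTo (suc x)) ⟩
    ∑ (λ b → ∑ h (map (b ∷_) (boxes e))) (upTo (suc x))
      ≡⟨ ∑-upTo (λ b → ∑ h (map (b ∷_) (boxes e))) (suc x) ⟩
    ∑< (suc x) (λ b → ∑ h (map (b ∷_) (boxes e)))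
      ≈⟨ ∑<-cong-≡ (suc x) (λ b _ → ∑-map h (b ∷_) (boxes e)) ⟩
    ∑< (suc x) (λ b → ∑ (λ e′ → f (b ∷ e′) * g ((x ∸ b) ∷ zipWith _∸_ e e′)) (boxes e)) ∎
    where
    h : List ℕ → Carrier
    h e′ = f e′ * g (zipWith _∸_ (x ∷ e) e′)

  ∑<-delta : ∀ x A B Y → ∑< (suc x) (λ b → cond ((A == b) ∧ (B == (x ∸ b))) Y) ≈ cond ((A N.+ B) == x) Y
  ∑<-delta x zero B Y = begin
    ∑< (suc x) (λ b → cond ((0 == b) ∧ (B == (x ∸ b))) Y)
      ≈⟨ ∑<-suc x _ ⟩
    cond ((0 == 0) ∧ (B == x)) Y + ∑< x (λ b → cond ((0 == suc b) ∧ (B == (x ∸ suc b))) Y)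
      ≈⟨ +-congˡ (trans (∑<-cong-≡ x (λ b _ → P.cong (λ t → cond (t ∧ (B == (x ∸ suc b))) Y) (==-≢ {0} {suc b} λ ()))) (∑<-0 x)) ⟩
    cond (B == x) Y + 0#
      ≈⟨ +-identityʳ _ ⟩
    cond (B == x) Y ∎
  ∑<-delta zero (suc A) B Y = trans (∑<-1 _)
    (reflexive (P.trans (P.cong (λ t → cond (t ∧ (B == 0)) Y) (==-≢ {suc A} {0} λ ()))
                       (P.cong (λ t → cond t Y) (P.sym (==-≢ {suc A N.+ B} {0} λ ())))))
  ∑<-delta (suc x) (suc A) B Y = begin
    ∑< (suc (suc x)) (λ b → cond ((suc A == b) ∧ (B == (suc x ∸ b))) Y)
      ≈⟨ ∑<-suc (suc x) _ ⟩
    cond ((suc A == 0) ∧ (B == suc x)) Y + ∑< (suc x) (λ b → cond ((suc A == suc b) ∧ (B == (x ∸ b))) Y)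
      ≈⟨ +-cong (reflexive (P.cong (λ t → cond (t ∧ (B == suc x)) Y) (==-≢ {suc A} {0} λ ())))
                (∑<-cong-≡ (suc x) (λ b _ → P.cong (λ t → cond (t ∧ (B == (x ∸ b))) Y) (==-suc A b))) ⟩
    0# + ∑< (suc x) (λ b → cond ((A == b) ∧ (B == (x ∸ b))) Y)
      ≈⟨ +-identityˡ _ ⟩
    ∑< (suc x) (λ b → cond ((A == b) ∧ (B == (x ∸ b))) Y)
      ≈⟨ ∑<-delta x A B Y ⟩
    cond ((A N.+ B) == x) Y
      ≡⟨ P.cong (λ t → cond t Y) (==-suc (A N.+ B) x) ⟨
    cond ((suc A N.+ B) == suc x) Y ∎

  ⊗-η-∷ : ∀ α β x e → (η α ⊗ η β) (x ∷ e) ≈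
          ∑< (suc (length α)) (λ p → ∑< (suc (length β)) (λ s →
            cond ((sum (take p α) N.+ sum (take s β)) == x) (weight p * weight s * (η (drop p α) ⊗ η (drop s β)) e)))
  ⊗-η-∷ α β x e = begin
    (η α ⊗ η β) (x ∷ e)
      ≈⟨ ⊗-∷ (η α) (η β) x e ⟩
    ∑< (suc x) (λ b → ∑ (λ e′ → η α (b ∷ e′) * η β ((x ∸ b) ∷ zipWith _∸_ e e′)) (boxes e))
      ≈⟨ ∑<-cong (suc x) (λ b _ → ∑-cong (λ e′ → expand b e′) (boxes e)) ⟩
    ∑< (suc x) (λ b → ∑ (λ e′ → ∑< (suc n) (λ p → ∑< (suc m) (λ s → term b p s e′))) (boxes e))
      ≈⟨ ∑<-cong (suc x) (λ b _ → trans (∑-∑<-comm (suc n) (λ e′ p → ∑< (suc m) (λ s → term b p s e′)) (boxes e))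
                                       (∑<-cong (suc n) (λ p _ → ∑-∑<-comm (suc m) (λ e′ s → term b p s e′) (boxes e)))) ⟩
    ∑< (suc x) (λ b → ∑< (suc n) (λ p → ∑< (suc m) (λ s → ∑ (term b p s) (boxes e))))
      ≈⟨ ∑<-comm (suc x) (suc n) _ ⟩
    ∑< (suc n) (λ p → ∑< (suc x) (λ b → ∑< (suc m) (λ s → ∑ (term b p s) (boxes e))))
      ≈⟨ ∑<-cong (suc n) (λ p _ → ∑<-comm (suc x) (suc m) _) ⟩
    ∑< (suc n) (λ p → ∑< (suc m) (λ s → ∑< (suc x) (λ b → ∑ (term b p s) (boxes e))))
      ≈⟨ ∑<-cong (suc n) (λ p _ → ∑<-cong (suc m) (λ s _ → collapse p s)) ⟩
    ∑< (suc n) (λ p → ∑< (suc m) (λ s →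
      cond ((A p N.+ B s) == x) (weight p * weight s * (η (drop p α) ⊗ η (drop s β)) e))) ∎
    where
    n = length α
    m = length β
    A = λ p → sum (take p α)
    B = λ s → sum (take s β)
    term : ℕ → ℕ → ℕ → List ℕ → Carrier
    term b p s e′ = cond (A p == b) (weight p * η (drop p α) e′) * cond (B s == (x ∸ b)) (weight s * η (drop s β) (zipWith _∸_ e e′))
    expand : ∀ b e′ → η α (b ∷ e′) * η β ((x ∸ b) ∷ zipWith _∸_ e e′) ≈ ∑< (suc n) (λ p → ∑< (suc m) (λ s → term b p s e′))
    expand b e′ = trans (*-cong (η-∷ α b e′) (η-∷ β (x ∸ b) (zipWith _∸_ e e′))) (∑<-*-∑< (suc n) (suc m) _ _)
    both : ℕ → ℕ → List ℕ → Carrier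
    both p s e′ = (weight p * η (drop p α) e′) * (weight s * η (drop s β) (zipWith _∸_ e e′))
    product : ∀ p s e′ → both p s e′ ≈
                         weight p * weight s * (η (drop p α) e′ * η (drop s β) (zipWith _∸_ e e′))
    product p s e′ = *-interchange _ _ _ _
    collapse : ∀ p s → ∑< (suc x) (λ b → ∑ (term b p s) (boxes e)) ≈
               cond ((A p N.+ B s) == x) (weight p * weight s * (η (drop p α) ⊗ η (drop s β)) e)
    collapse p s = begin
      ∑< (suc x) (λ b → ∑ (term b p s) (boxes e))
        ≈⟨ ∑<-cong (suc x) (λ b _ → trans (∑-cong (λ e′ → cond-∧ _ _ _ _) (boxes e))
                                          (∑-cond ((A p == b) ∧ (B s == (x ∸ b))) (both p s) (boxes e))) ⟩
      ∑< (suc x) (λ b → cond ((A p == b) ∧ (B s == (x ∸ b))) (∑ (both p s) (boxes e)))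
        ≈⟨ ∑<-delta x (A p) (B s) _ ⟩
      cond ((A p N.+ B s) == x) (∑ (both p s) (boxes e))
        ≈⟨ cond-cong ((A p N.+ B s) == x) (trans (∑-cong (product p s) (boxes e))
             (trans (sym (∑-*ˡ (weight p * weight s) _ (boxes e))) (*-congˡ (reflexive (P.sym (⊗-∑ (η (drop p α)) (η (drop s β)) e)))))) ⟩
      cond ((A p N.+ B s) == x) (weight p * weight s * (η (drop p α) ⊗ η (drop s β)) e) ∎

  -- The sum over I and J as a product of commuting operators, one per t ∈ T

  -- I ⊆ T ∖ {n+m} and J ⊆ T ∖ {1, n+m}: whether t may lie in I, resp. in J, when N = n + m
  mayI : ℕ → ℕ → Bool
  mayI t N = not (t == N)

  mayJ : ℕ → ℕ → Bool
  mayJ t N = not (t == 1) ∧ not (t == N)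

  merge : ℕ → ℕ → (List ℕ → Carrier) → List ℕ → Carrier
  merge t N h δ = h δ + (cond (mayI t N) ((q - 1#) * h (down1 t δ)) + cond (mayJ t N) ((- q) * h (down1 (t ∸ 1) (down1 t δ))))

  mergeAll : List ℕ → ℕ → (List ℕ → Carrier) → List ℕ → Carrier
  mergeAll []      N h = h
  mergeAll (t ∷ T) N h = mergeAll T N (merge t N h)

  merge-cong : ∀ t N {h h′ : List ℕ → Carrier} → (∀ δ → h δ ≈ h′ δ) → ∀ δ → merge t N h δ ≈ merge t N h′ δ
  merge-cong t N h≈h′ δ = +-cong (h≈h′ δ) (+-cong (cond-cong (mayI t N) (*-congˡ (h≈h′ _))) (cond-cong (mayJ t N) (*-congˡ (h≈h′ _))))

  mergeAll-cong : ∀ T N {h h′ : List ℕ → Carrier} → (∀ δ → h δ ≈ h′ δ) → ∀ δ → mergeAll T N h δ ≈ mergeAll T N h′ δ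
  mergeAll-cong []      N h≈h′ = h≈h′
  mergeAll-cong (t ∷ T) N h≈h′ = mergeAll-cong T N (merge-cong t N h≈h′)

  merge-N : ∀ t h δ → merge t t h δ ≈ h δ
  merge-N t h δ rewrite ==-refl t | BP.∧-zeroʳ (not (t == 1)) = trans (+-congˡ (+-identityˡ 0#)) (+-identityʳ _)

  merge-1 : ∀ N h δ → 1 ≢ N → merge 1 N h δ ≈ h δ + ((q - 1#) * h (down1 1 δ) + 0# * h (down1 0 (down1 1 δ)))
  merge-1 N h δ 1≢N rewrite ==-≢ 1≢N = +-congˡ (+-congˡ (sym (zeroˡ _)))

  merge-mid : ∀ t N h δ → t ≢ N → t ≢ 1 → merge t N h δ ≈ h δ + ((q - 1#) * h (down1 t δ) + (- q) * h (down1 (t ∸ 1) (down1 t δ)))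
  merge-mid t N h δ t≢N t≢1 rewrite ==-≢ t≢N | ==-≢ t≢1 = refl

  ijTerm : (List ℕ → Carrier) → List ℕ → List ℕ → List ℕ → Carrier
  ijTerm h γ I J = if disjoint I J then pow (q - 1#) (length I) * pow (- q) (length J) * h (downIJ γ I J) else 0#

  ijSumOver : List (List ℕ) → List (List ℕ) → (List ℕ → Carrier) → List ℕ → Carrier
  ijSumOver Is Js h γ = ∑ (λ I → ∑ (ijTerm h γ I) Js) Is

  ijSum : List ℕ → ℕ → (List ℕ → Carrier) → List ℕ → Carrier
  ijSum T N = ijSumOver (subs (without (N ∷ []) T)) (subs (without (1 ∷ N ∷ []) T))

  ijTerm-cong : ∀ {h h′ : List ℕ → Carrier} → (∀ δ → h δ ≈ h′ δ) → ∀ γ I J → ijTerm h γ I J ≈ ijTerm h′ γ I J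
  ijTerm-cong h≈h′ γ I J with disjoint I J
  ... | true  = *-congˡ (h≈h′ _)
  ... | false = refl

  ijSumOver-cong : ∀ Is Js {h h′ : List ℕ → Carrier} → (∀ δ → h δ ≈ h′ δ) → ∀ γ → ijSumOver Is Js h γ ≈ ijSumOver Is Js h′ γ
  ijSumOver-cong Is Js h≈h′ γ = ∑-cong (λ I → ∑-cong (ijTerm-cong h≈h′ γ I) Js) Is

  ijTerm-linear : ∀ h a b (h₁ h₂ : List ℕ → Carrier) γ I J →
    ijTerm (λ δ → h δ + (a * h₁ δ + b * h₂ δ)) γ I J ≈ ijTerm h γ I J + (a * ijTerm h₁ γ I J + b * ijTerm h₂ γ I J)
  ijTerm-linear h a b h₁ h₂ γ I J with disjoint I J
  ... | false = sym (trans (+-congˡ (+-cong (zeroʳ a) (zeroʳ b))) (trans (+-identityˡ _) (+-identityˡ _)))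
  ... | true  = trans (distribˡ _ _ _) (+-congˡ (trans (distribˡ _ _ _) (+-cong (x∙yz≈y∙xz _ a _) (x∙yz≈y∙xz _ b _))))
    where open CommSemigroupProperties *-commutativeSemigroup using (x∙yz≈y∙xz)

  ijSumOver-linear : ∀ Is Js h a b h₁ h₂ γ →
    ijSumOver Is Js (λ δ → h δ + (a * h₁ δ + b * h₂ δ)) γ ≈
    ijSumOver Is Js h γ + (a * ijSumOver Is Js h₁ γ + b * ijSumOver Is Js h₂ γ)
  ijSumOver-linear Is Js h a b h₁ h₂ γ =
    trans (∑-cong (λ I → trans (∑-cong (ijTerm-linear h a b h₁ h₂ γ I) Js) (∑-linear _ _ _ a b Js)) Is) (∑-linear _ _ _ a b Is)

  ijTerm-∷ˡ : ∀ h γ t I J → 1 ≤ t → t < length γ → All (suc (suc t) ≤_) I → All (suc (suc t) ≤_) J →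
              ijTerm h γ (t ∷ I) J ≈ (q - 1#) * ijTerm (h ∘ down1 t) γ I J
  ijTerm-∷ˡ h γ t I J 1≤t t<|γ| t+2≤I t+2≤J
    rewrite disjoint-∷ˡ t I J t+2≤J | downIJ-∷ˡ γ t I J 1≤t t<|γ| t+2≤I t+2≤J with disjoint I J
  ... | true  = trans (*-congʳ (*-assoc _ _ _)) (*-assoc _ _ _)
  ... | false = sym (zeroʳ _)

  ijTerm-∷ʳ : ∀ h γ t I J → 2 ≤ t → t < length γ → All (suc (suc t) ≤_) I → All (suc (suc t) ≤_) J →
              ijTerm h γ I (t ∷ J) ≈ (- q) * ijTerm (h ∘ down1 (t ∸ 1) ∘ down1 t) γ I J
  ijTerm-∷ʳ h γ t I J 2≤t t<|γ| t+2≤I t+2≤J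
    rewrite disjoint-∷ʳ t I J t+2≤I | downIJ-∷ʳ γ t I J 2≤t t<|γ| t+2≤I t+2≤J with disjoint I J
  ... | true  = trans (*-congʳ (x∙yz≈y∙xz _ _ _)) (*-assoc _ _ _)
    where open CommSemigroupProperties *-commutativeSemigroup using (x∙yz≈y∙xz)
  ... | false = sym (zeroʳ _)

  ijTerm-∷-∷ : ∀ h γ t I J → ijTerm h γ (t ∷ I) (t ∷ J) ≈ 0#
  ijTerm-∷-∷ h γ t I J rewrite disjoint-∷-∷ t I J = refl

  ∑-subs-∷ : ∀ (f : List ℕ → Carrier) t T → ∑ f (subs (t ∷ T)) ≈ ∑ f (subs T) + ∑ (f ∘ (t ∷_)) (subs T)
  ∑-subs-∷ f t T = trans (∑-++ f (subs T) (map (t ∷_) (subs T))) (+-congˡ (reflexive (∑-map f (t ∷_) (subs T))))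

  module _ (t : ℕ) (T : List ℕ) (t+2≤T : All (suc (suc t) ≤_) T) where

    private
      subs-above : ∀ Rm → All (All (suc (suc t) ≤_)) (subs (without Rm T))
      subs-above Rm = subs-All (bfilter-All _ t+2≤T)

    ijSum-∷-last : ∀ h γ → ijSum (t ∷ T) t h γ ≈ ijSum T t (merge t t h) γ
    ijSum-∷-last h γ = trans
      (reflexive (P.cong₂ (λ A B → ijSumOver (subs A) (subs B) h γ)
        (without-∈ (t ∷ []) t T (P.cong (_∨ false) (==-refl t)))
        (without-∈ (1 ∷ t ∷ []) t T (P.trans (P.cong (λ b → (t == 1) ∨ (b ∨ false)) (==-refl t)) (BP.∨-zeroʳ (t == 1))))))
      (ijSumOver-cong _ _ (λ δ → sym (merge-N t h δ)) γ)

    ijSum-∷-first : ∀ N h γ → t ≡ 1 → t < length γ → t ≢ N → ijSum (t ∷ T) N h γ ≈ ijSum T N (merge t N h) γ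
    ijSum-∷-first N h γ P.refl 1<|γ| 1≢N = begin
      ijSum (1 ∷ T) N h γ
        ≡⟨ P.cong (λ A → ijSumOver (subs A) (subs B) h γ) (without-∉ (N ∷ []) 1 T (P.cong (_∨ false) (==-≢ 1≢N))) ⟩
      ijSumOver (subs (1 ∷ A)) (subs B) h γ
        ≈⟨ ∑-subs-∷ (λ I → ∑ (ijTerm h γ I) (subs B)) 1 A ⟩
      ijSum T N h γ + ∑ (λ I → ∑ (ijTerm h γ (1 ∷ I)) (subs B)) (subs A)
        ≈⟨ +-congˡ (∑∑-scale _ _ (q - 1#) (λ I J → ijTerm-∷ˡ h γ 1 I J NP.≤-refl 1<|γ|) (subs-above (N ∷ [])) (subs-above (1 ∷ N ∷ []))) ⟩
      ijSum T N h γ + (q - 1#) * ijSum T N (h ∘ down1 1) γ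
        ≈⟨ +-congˡ (trans (+-congˡ (zeroˡ _)) (+-identityʳ _)) ⟨
      ijSum T N h γ + ((q - 1#) * ijSum T N (h ∘ down1 1) γ + 0# * ijSum T N (h ∘ down1 0 ∘ down1 1) γ)
        ≈⟨ ijSumOver-linear (subs A) (subs B) h (q - 1#) 0# (h ∘ down1 1) (h ∘ down1 0 ∘ down1 1) γ ⟨
      ijSum T N (λ δ → h δ + ((q - 1#) * h (down1 1 δ) + 0# * h (down1 0 (down1 1 δ)))) γ
        ≈⟨ ijSumOver-cong (subs A) (subs B) (λ δ → merge-1 N h δ 1≢N) γ ⟨
      ijSum T N (merge 1 N h) γ ∎
      where
      A = without (N ∷ []) T
      B = without (1 ∷ N ∷ []) T

    ijSum-∷-middle : ∀ N h γ → 2 ≤ t → t < length γ → t ≢ N → ijSum (t ∷ T) N h γ ≈ ijSum T N (merge t N h) γ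
    ijSum-∷-middle N h γ 2≤t t<|γ| t≢N = begin
      ijSum (t ∷ T) N h γ
        ≡⟨ P.cong₂ (λ A B → ijSumOver (subs A) (subs B) h γ)
             (without-∉ (N ∷ []) t T (P.cong (_∨ false) (==-≢ t≢N)))
             (without-∉ (1 ∷ N ∷ []) t T (P.cong₂ _∨_ (==-≢ t≢1) (P.cong (_∨ false) (==-≢ t≢N)))) ⟩
      ∑ (λ I → ∑ (ijTerm h γ I) (subs (t ∷ B))) (subs (t ∷ A))
        ≈⟨ ∑-cong (λ I → ∑-subs-∷ (ijTerm h γ I) t B) (subs (t ∷ A)) ⟩
      ∑ (λ I → ∑ (ijTerm h γ I) (subs B) + ∑ (ijTerm h γ I ∘ (t ∷_)) (subs B)) (subs (t ∷ A))
        ≈⟨ ∑-subs-∷ (λ I → ∑ (ijTerm h γ I) (subs B) + ∑ (ijTerm h γ I ∘ (t ∷_)) (subs B)) t A ⟩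
      ∑ (λ I → ∑ (ijTerm h γ I) (subs B) + ∑ (ijTerm h γ I ∘ (t ∷_)) (subs B)) (subs A) +
      ∑ (λ I → ∑ (ijTerm h γ (t ∷ I)) (subs B) + ∑ (ijTerm h γ (t ∷ I) ∘ (t ∷_)) (subs B)) (subs A)
        ≈⟨ +-cong (∑-+ _ _ (subs A)) (∑-+ _ _ (subs A)) ⟩
      (ijSum T N h γ + ∑ (λ I → ∑ (ijTerm h γ I ∘ (t ∷_)) (subs B)) (subs A)) +
      (∑ (λ I → ∑ (ijTerm h γ (t ∷ I)) (subs B)) (subs A) + ∑ (λ I → ∑ (ijTerm h γ (t ∷ I) ∘ (t ∷_)) (subs B)) (subs A))
        ≈⟨ +-cong (+-congˡ (∑∑-scale _ _ (- q) (λ I J → ijTerm-∷ʳ h γ t I J 2≤t t<|γ|) (subs-above (N ∷ [])) (subs-above (1 ∷ N ∷ []))))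
                  (+-cong (∑∑-scale _ _ (q - 1#) (λ I J → ijTerm-∷ˡ h γ t I J 1≤t t<|γ|) (subs-above (N ∷ [])) (subs-above (1 ∷ N ∷ [])))
                          (trans (∑-cong (λ I → trans (∑-cong (ijTerm-∷-∷ h γ t I) (subs B)) (∑-0 (subs B))) (subs A)) (∑-0 (subs A)))) ⟩
      (ijSum T N h γ + (- q) * ijSum T N (h ∘ down1 (t ∸ 1) ∘ down1 t) γ) + ((q - 1#) * ijSum T N (h ∘ down1 t) γ + 0#)
        ≈⟨ trans (+-congˡ (+-identityʳ _)) (solve 3 (λ x y z → (x ⊕ y) ⊕ z ⊜ x ⊕ (z ⊕ y)) refl _ _ _) ⟩
      ijSum T N h γ + ((q - 1#) * ijSum T N (h ∘ down1 t) γ + (- q) * ijSum T N (h ∘ down1 (t ∸ 1) ∘ down1 t) γ)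
        ≈⟨ ijSumOver-linear (subs A) (subs B) h (q - 1#) (- q) (h ∘ down1 t) (h ∘ down1 (t ∸ 1) ∘ down1 t) γ ⟨
      ijSum T N (λ δ → h δ + ((q - 1#) * h (down1 t δ) + (- q) * h (down1 (t ∸ 1) (down1 t δ)))) γ
        ≈⟨ ijSumOver-cong (subs A) (subs B) (λ δ → merge-mid t N h δ t≢N t≢1) γ ⟨
      ijSum T N (merge t N h) γ ∎
      where
      A = without (N ∷ []) T
      B = without (1 ∷ N ∷ []) T
      1≤t : 1 ≤ t
      1≤t = NP.<⇒≤ 2≤t
      t≢1 : t ≢ 1
      t≢1 t≡1 = NP.<-irrefl (P.sym t≡1) 2≤t

  ijSum-∷ : ∀ t T N h γ → All (suc (suc t) ≤_) T → 1 ≤ t → t ≤ N → length γ ≡ N →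
            ijSum (t ∷ T) N h γ ≈ ijSum T N (merge t N h) γ
  ijSum-∷ t T N h γ t+2≤T 1≤t t≤N |γ|≡N = cases (t N.≟ N) (t N.≟ 1)
    where
    cases : Dec (t ≡ N) → Dec (t ≡ 1) → ijSum (t ∷ T) N h γ ≈ ijSum T N (merge t N h) γ
    cases (yes P.refl) _         = ijSum-∷-last t T t+2≤T h γ
    cases (no t≢N)     (yes t≡1) = ijSum-∷-first t T t+2≤T N h γ t≡1 (P.subst (t <_) (P.sym |γ|≡N) (NP.≤∧≢⇒< t≤N t≢N)) t≢N
    cases (no t≢N)     (no t≢1)  = ijSum-∷-middle t T t+2≤T N h γ (NP.≤∧≢⇒< 1≤t (t≢1 ∘ P.sym))
                                     (P.subst (t <_) (P.sym |γ|≡N) (NP.≤∧≢⇒< t≤N t≢N)) t≢N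

  -- Each element t of T lies in I, in J or in neither; as the elements of T are at least 2 apart,
  -- these choices do not interact and contribute the factor merge t.
  ijSum≈mergeAll : ∀ T N h γ → Sparse T → All (1 ≤_) T → All (_≤ N) T → length γ ≡ N → ijSum T N h γ ≈ mergeAll T N h γ
  ijSum≈mergeAll []      N h γ _ _ _ _ = begin
    ∑ (λ I → ∑ (ijTerm h γ I) (subs [])) (subs [])   ≈⟨ trans (∑-[-] _ []) (∑-[-] _ []) ⟩
    1# * 1# * h (downK (bfilter (λ _ → false) (range 1 (length γ))) γ)
      ≈⟨ trans (*-congʳ (*-identityˡ 1#)) (*-identityˡ _) ⟩
    h (downK (bfilter (λ _ → false) (range 1 (length γ))) γ)
      ≡⟨ P.cong (λ K → h (downK K γ)) (bfilter-false (range 1 (length γ))) ⟩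
    h γ ∎
  ijSum≈mergeAll (t ∷ T) N h γ (t+2≤T , sparse) (1≤t ∷ 1≤T) (t≤N ∷ T≤N) |γ|≡N =
    trans (ijSum-∷ t T N h γ t+2≤T 1≤t t≤N |γ|≡N) (ijSum≈mergeAll T N (merge t N h) γ sparse 1≤T T≤N |γ|≡N)

  merge-+ : ∀ t N f g δ → merge t N (λ d → f d + g d) δ ≈ merge t N f δ + merge t N g δ
  merge-+ t N f g δ = begin
    (f δ + g δ) + (cond (mayI t N) ((q - 1#) * (f _ + g _)) + cond (mayJ t N) ((- q) * (f _ + g _)))
      ≈⟨ +-congˡ (+-cong (trans (cond-cong (mayI t N) (distribˡ _ _ _)) (cond-+ _ _ _))
                         (trans (cond-cong (mayJ t N) (distribˡ _ _ _)) (cond-+ _ _ _))) ⟩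
    (f δ + g δ) + ((cond (mayI t N) ((q - 1#) * f _) + cond (mayI t N) ((q - 1#) * g _)) +
                   (cond (mayJ t N) ((- q) * f _) + cond (mayJ t N) ((- q) * g _)))
      ≈⟨ solve 6 (λ a b c d e f → (a ⊕ b) ⊕ ((c ⊕ d) ⊕ (e ⊕ f)) ⊜ (a ⊕ (c ⊕ e)) ⊕ (b ⊕ (d ⊕ f))) refl _ _ _ _ _ _ ⟩
    merge t N f δ + merge t N g δ ∎

  merge-* : ∀ t N a f δ → merge t N (λ d → a * f d) δ ≈ a * merge t N f δ
  merge-* t N a f δ = begin
    a * f δ + (cond (mayI t N) ((q - 1#) * (a * f _)) + cond (mayJ t N) ((- q) * (a * f _)))
      ≈⟨ +-congˡ (+-cong (trans (cond-cong (mayI t N) (x∙yz≈y∙xz _ _ _)) (cond-*ˡ _ a _))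
                         (trans (cond-cong (mayJ t N) (x∙yz≈y∙xz _ _ _)) (cond-*ˡ _ a _))) ⟩
    a * f δ + (a * cond (mayI t N) ((q - 1#) * f _) + a * cond (mayJ t N) ((- q) * f _))
      ≈⟨ trans (distribˡ _ _ _) (+-congˡ (distribˡ _ _ _)) ⟨
    a * merge t N f δ ∎
    where open CommSemigroupProperties *-commutativeSemigroup using (x∙yz≈y∙xz)

  mergeAll-+ : ∀ T N f g δ → mergeAll T N (λ d → f d + g d) δ ≈ mergeAll T N f δ + mergeAll T N g δ
  mergeAll-+ []      N f g δ = refl
  mergeAll-+ (t ∷ T) N f g δ = trans (mergeAll-cong T N (merge-+ t N f g) δ) (mergeAll-+ T N (merge t N f) (merge t N g) δ)

  mergeAll-* : ∀ T N a f δ → mergeAll T N (λ d → a * f d) δ ≈ a * mergeAll T N f δ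
  mergeAll-* []      N a f δ = refl
  mergeAll-* (t ∷ T) N a f δ = trans (mergeAll-cong T N (merge-* t N a f) δ) (mergeAll-* T N a (merge t N f) δ)

  mergeAll-cond : ∀ T N b f δ → mergeAll T N (λ d → cond b (f d)) δ ≈ cond b (mergeAll T N f δ)
  mergeAll-cond T N true  f δ = refl
  mergeAll-cond T N false f δ =
    trans (mergeAll-cong T N (λ _ → sym (zeroˡ 0#)) δ) (trans (mergeAll-* T N 0# (λ _ → 0#) δ) (zeroˡ _))

  mergeAll-linear : ∀ T N (f g k : List ℕ → Carrier) b₁ b₂ a₁ a₂ δ →
    mergeAll T N (λ d → f d + (cond b₁ (a₁ * g d) + cond b₂ (a₂ * k d))) δ ≈
    mergeAll T N f δ + (cond b₁ (a₁ * mergeAll T N g δ) + cond b₂ (a₂ * mergeAll T N k δ))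
  mergeAll-linear T N f g k b₁ b₂ a₁ a₂ δ = begin
    mergeAll T N (λ d → f d + (cond b₁ (a₁ * g d) + cond b₂ (a₂ * k d))) δ
      ≈⟨ mergeAll-+ T N f _ δ ⟩
    mergeAll T N f δ + mergeAll T N (λ d → cond b₁ (a₁ * g d) + cond b₂ (a₂ * k d)) δ
      ≈⟨ +-congˡ (mergeAll-+ T N _ _ δ) ⟩
    mergeAll T N f δ + (mergeAll T N (λ d → cond b₁ (a₁ * g d)) δ + mergeAll T N (λ d → cond b₂ (a₂ * k d)) δ)
      ≈⟨ +-congˡ (+-cong (trans (mergeAll-cond T N b₁ _ δ) (cond-cong b₁ (mergeAll-* T N a₁ g δ)))
                         (trans (mergeAll-cond T N b₂ _ δ) (cond-cong b₂ (mergeAll-* T N a₂ k δ)))) ⟩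
    mergeAll T N f δ + (cond b₁ (a₁ * mergeAll T N g δ) + cond b₂ (a₂ * mergeAll T N k δ)) ∎

  mergeAll-cong-bounded : ∀ T N m M {h h′ : List ℕ → Carrier} → All (suc (suc m) ≤_) T →
    (∀ d → m < length d → length d ≤ M → h d ≈ h′ d) → ∀ δ → m < length δ → length δ ≤ M → mergeAll T N h δ ≈ mergeAll T N h′ δ
  mergeAll-cong-bounded []      N m M m+2≤T h≈h′ δ m<|δ| |δ|≤M = h≈h′ δ m<|δ| |δ|≤M
  mergeAll-cong-bounded (t ∷ T) N m M {h} {h′} (m+2≤t ∷ m+2≤T) h≈h′ = mergeAll-cong-bounded T N m M m+2≤T step
    where
    m<t : m < t
    m<t = NP.<⇒≤ m+2≤t
    step : ∀ d → m < length d → length d ≤ M → merge t N h d ≈ merge t N h′ d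
    step d m<|d| |d|≤M = +-cong (h≈h′ d m<|d| |d|≤M) (+-cong
      (cond-cong (mayI t N) (*-congˡ (h≈h′ _ (length-down1-> t d m m<t m<|d|) (NP.≤-trans (length-down1-≤ t d) |d|≤M))))
      (cond-cong (mayJ t N) (*-congˡ (h≈h′ _ (length-down1-> (t ∸ 1) _ m (NP.∸-monoˡ-≤ 1 m+2≤t) (length-down1-> t d m m<t m<|d|))
                                              (NP.≤-trans (length-down1-≤ (t ∸ 1) _) (NP.≤-trans (length-down1-≤ t d) |d|≤M))))))

  -- Merging commutes with cutting a word into a prefix and a suffix

  splitSum : {A : Set} → (List A → List A → Carrier) → List A → Carrier
  splitSum F δ = ∑< (suc (length δ)) (λ r → F (take r δ) (drop r δ))

  -- merge t applied to the side of the cut containing the positions t and t + 1; nothing if the cut separates them.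
  mergeSide : (List ℕ → List ℕ → Carrier) → ℕ → ℕ → List ℕ → List ℕ → Carrier
  mergeSide F t N d₁ d₂ with NP.<-cmp t (length d₁)
  ... | tri< _ _ _ = merge t (length d₁) (λ d → F d d₂) d₁
  ... | tri≈ _ _ _ = F d₁ d₂
  ... | tri> _ _ _ = merge (t ∸ length d₁) (N ∸ length d₁) (F d₁) d₂

  mergeSide-left : ∀ F t N d₁ d₂ → t < length d₁ → mergeSide F t N d₁ d₂ ≡ merge t (length d₁) (λ d → F d d₂) d₁
  mergeSide-left F t N d₁ d₂ t<|d₁| with NP.<-cmp t (length d₁)
  ... | tri< _ _ _      = P.refl
  ... | tri≈ _ t≡|d₁| _ = contradiction t<|d₁| (NP.<-irrefl t≡|d₁|)
  ... | tri> _ _ t>|d₁| = contradiction t<|d₁| (NP.<-asym t>|d₁|)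

  mergeSide-cut : ∀ F t N d₁ d₂ → length d₁ ≡ t → mergeSide F t N d₁ d₂ ≡ F d₁ d₂
  mergeSide-cut F t N d₁ d₂ |d₁|≡t with NP.<-cmp t (length d₁)
  ... | tri< t<|d₁| _ _ = contradiction t<|d₁| (NP.<-irrefl (P.sym |d₁|≡t))
  ... | tri≈ _ _ _      = P.refl
  ... | tri> _ _ t>|d₁| = contradiction t>|d₁| (NP.<-irrefl |d₁|≡t)

  mergeSide-right : ∀ F t N d₁ d₂ → length d₁ < t → mergeSide F t N d₁ d₂ ≡ merge (t ∸ length d₁) (N ∸ length d₁) (F d₁) d₂
  mergeSide-right F t N d₁ d₂ |d₁|<t with NP.<-cmp t (length d₁)
  ... | tri< t<|d₁| _ _ = contradiction |d₁|<t (NP.<-asym t<|d₁|)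
  ... | tri≈ _ t≡|d₁| _ = contradiction |d₁|<t (NP.<-irrefl (P.sym t≡|d₁|))
  ... | tri> _ _ _      = P.refl

  -- The cut between the positions t and t + 1 disappears in down1 t δ; every other cut sees down1 on one side.
  splitSum-down1 : ∀ F t δ k → 1 ≤ t → length δ ≡ t N.+ suc k →
    splitSum F (down1 t δ) ≈ ∑< t (λ r → F (take r δ) (down1 (t ∸ r) (drop r δ)))
                             + ∑< (suc k) (λ i → F (down1 t (take (suc (t N.+ i)) δ)) (drop (suc (t N.+ i)) δ))
  splitSum-down1 F t δ k 1≤t |δ|≡ = begin
    ∑< (suc (length (down1 t δ))) f  ≡⟨ P.cong (λ n → ∑< n f) (P.trans (P.cong suc |↓δ|≡) (P.sym (NP.+-suc t k))) ⟩
    ∑< (t N.+ suc k) f               ≈⟨ ∑<-split t (suc k) f ⟩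
    ∑< t f + ∑< (suc k) (λ i → f (t N.+ i))
      ≈⟨ +-cong (∑<-cong-≡ t (λ r r<t → P.cong₂ F (take-down1-< t r δ r<t) (drop-down1-< t r δ r<t)))
                (∑<-cong-≡ (suc k) (λ i _ → P.cong₂ F (take-down1-≥ t i δ 1≤t) (drop-down1-≥ t i δ 1≤t))) ⟩
    ∑< t (λ r → F (take r δ) (down1 (t ∸ r) (drop r δ)))
      + ∑< (suc k) (λ i → F (down1 t (take (suc (t N.+ i)) δ)) (drop (suc (t N.+ i)) δ)) ∎
    where
    f = λ r → F (take r (down1 t δ)) (drop r (down1 t δ))
    t<|δ| : t < length δ
    t<|δ| rewrite |δ|≡ | NP.+-suc t k = s≤s (NP.m≤m+n t k)
    |↓δ|≡ : length (down1 t δ) ≡ t N.+ k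
    |↓δ|≡ = NP.suc-injective (P.trans (length-down1 t δ 1≤t t<|δ|) (P.trans |δ|≡ (NP.+-suc t k)))

  splitSum-down1-down1 : ∀ F t δ k → 2 ≤ t → length δ ≡ t N.+ suc k →
    splitSum F (down1 (t ∸ 1) (down1 t δ)) ≈
      ∑< (t ∸ 1) (λ r → F (take r δ) (down1 (t ∸ r ∸ 1) (down1 (t ∸ r) (drop r δ))))
      + ∑< (suc k) (λ i → F (down1 (t ∸ 1) (down1 t (take (suc (t N.+ i)) δ))) (drop (suc (t N.+ i)) δ))
  splitSum-down1-down1 F (suc t′) δ k (s≤s 1≤t′) |δ|≡ = begin
    splitSum F (down1 t′ (down1 (suc t′) δ))
      ≈⟨ splitSum-down1 F t′ (down1 (suc t′) δ) k 1≤t′ |↓δ|≡ ⟩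
    ∑< t′ (λ r → F (take r (down1 (suc t′) δ)) (down1 (t′ ∸ r) (drop r (down1 (suc t′) δ))))
      + ∑< (suc k) (λ i → F (down1 t′ (take (suc (t′ N.+ i)) (down1 (suc t′) δ))) (drop (suc (t′ N.+ i)) (down1 (suc t′) δ)))
      ≈⟨ +-cong (∑<-cong-≡ t′ (λ r r<t′ → P.cong₂ F (take-down1-< (suc t′) r δ (NP.m≤n⇒m≤1+n r<t′)) (prefix r r<t′)))
                (∑<-cong-≡ (suc k) (λ i _ → P.cong₂ (λ a b → F (down1 t′ a) b)
                                                   (take-down1-≥ (suc t′) i δ (s≤s z≤n)) (drop-down1-≥ (suc t′) i δ (s≤s z≤n)))) ⟩
    ∑< t′ (λ r → F (take r δ) (down1 (suc t′ ∸ r ∸ 1) (down1 (suc t′ ∸ r) (drop r δ))))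
      + ∑< (suc k) (λ i → F (down1 t′ (down1 (suc t′) (take (suc (suc t′ N.+ i)) δ))) (drop (suc (suc t′ N.+ i)) δ)) ∎
    where
    t<|δ| : suc t′ < length δ
    t<|δ| rewrite |δ|≡ | NP.+-suc (suc t′) k = s≤s (NP.m≤m+n (suc t′) k)
    |↓δ|≡ : length (down1 (suc t′) δ) ≡ t′ N.+ suc k
    |↓δ|≡ = NP.suc-injective (P.trans (length-down1 (suc t′) δ (s≤s z≤n) t<|δ|) |δ|≡)
    prefix : ∀ r → r < t′ → down1 (t′ ∸ r) (drop r (down1 (suc t′) δ)) ≡ down1 (suc t′ ∸ r ∸ 1) (down1 (suc t′ ∸ r) (drop r δ))
    prefix r r<t′ rewrite drop-down1-< (suc t′) r δ (NP.m≤n⇒m≤1+n r<t′) | NP.+-∸-assoc 1 (NP.<⇒≤ r<t′) = P.refl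

  -- For t = 1 the (-q)-term of merge t vanishes, so splitSum-down1-down1 is only needed for t ≥ 2
  cond-mayJ-splitSum : ∀ F t N δ k → 1 ≤ t → length δ ≡ t N.+ suc k →
    cond (mayJ t N) ((- q) * splitSum F (down1 (t ∸ 1) (down1 t δ))) ≈
    cond (mayJ t N) ((- q) * (∑< (t ∸ 1) (λ r → F (take r δ) (down1 (t ∸ r ∸ 1) (down1 (t ∸ r) (drop r δ))))
                              + ∑< (suc k) (λ i → F (down1 (t ∸ 1) (down1 t (take (suc (t N.+ i)) δ))) (drop (suc (t N.+ i)) δ))))
  cond-mayJ-splitSum F (suc zero)     N δ k _ _    = refl
  cond-mayJ-splitSum F (suc (suc t′)) N δ k _ |δ|≡ =
    cond-cong (mayJ (suc (suc t′)) N) (*-congˡ (splitSum-down1-down1 F (suc (suc t′)) δ k (s≤s (s≤s z≤n)) |δ|≡))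

  -- The cut r = t - 1 falls between the two merged positions, where mayJ (t ∸ r) is false
  ∑<-cond-mayJ : ∀ t N (f : ℕ → Carrier) → 1 ≤ t → (∀ r → suc r < t → mayJ (t ∸ r) (N ∸ r) ≡ mayJ t N) →
    ∑< t (λ r → cond (mayJ (t ∸ r) (N ∸ r)) ((- q) * f r)) ≈ cond (mayJ t N) ((- q) * ∑< (t ∸ 1) f)
  ∑<-cond-mayJ (suc t′) N f _ mayJ-r = begin
    ∑< (suc t′) g                           ≡⟨ P.cong (λ n → ∑< n g) (NP.+-comm 1 t′) ⟩
    ∑< (t′ N.+ 1) g                         ≈⟨ ∑<-split t′ 1 g ⟩
    ∑< t′ g + ∑< 1 (λ j → g (t′ N.+ j))     ≈⟨ +-cong (∑<-cong-≡ t′ (λ r r<t′ → P.cong (λ c → cond c ((- q) * f r)) (mayJ-r r (s≤s r<t′))))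
                                                      (trans (∑<-1 _) (reflexive (P.cong (λ c → cond c ((- q) * f (t′ N.+ 0))) last))) ⟩
    ∑< t′ (λ r → cond (mayJ (suc t′) N) ((- q) * f r)) + 0#
      ≈⟨ trans (+-identityʳ _) (∑<-cond-* t′ (mayJ (suc t′) N) (- q) f) ⟩
    cond (mayJ (suc t′) N) ((- q) * ∑< t′ f) ∎
    where
    g = λ r → cond (mayJ (suc t′ ∸ r) (N ∸ r)) ((- q) * f r)
    last : mayJ (suc t′ ∸ (t′ N.+ 0)) (N ∸ (t′ N.+ 0)) ≡ false
    last rewrite NP.+-identityʳ t′ | NP.m+n∸n≡m 1 t′ = P.refl

  module _ (F : List ℕ → List ℕ → Carrier) (t N : ℕ) (δ : List ℕ) (1≤t : 1 ≤ t) (t<|δ| : t < length δ) (|δ|≤N : length δ ≤ N) where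

    private
      k = length δ ∸ suc t
      |δ|≡ : length δ ≡ t N.+ suc k
      |δ|≡ = P.sym (P.trans (NP.+-suc t k) (NP.m+[n∸m]≡n t<|δ|))
      a = q - 1#
      b = - q
      whole : ℕ → Carrier
      whole r = F (take r δ) (drop r δ)
      whole⁺ : ℕ → Carrier
      whole⁺ i = whole (suc (t N.+ i))
      I₁ : ℕ → Carrier
      I₁ r = F (take r δ) (down1 (t ∸ r) (drop r δ))
      I₂ : ℕ → Carrier
      I₂ i = F (down1 t (take (suc (t N.+ i)) δ)) (drop (suc (t N.+ i)) δ)
      J₁ : ℕ → Carrier
      J₁ r = F (take r δ) (down1 (t ∸ r ∸ 1) (down1 (t ∸ r) (drop r δ)))
      J₂ : ℕ → Carrier
      J₂ i = F (down1 (t ∸ 1) (down1 t (take (suc (t N.+ i)) δ))) (drop (suc (t N.+ i)) δ)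
      sided : ℕ → Carrier
      sided r = mergeSide F t N (take r δ) (drop r δ)
      t<N : t < N
      t<N = NP.<-≤-trans t<|δ| |δ|≤N
      mayI≡ : ∀ i → mayI t (suc (t N.+ i)) ≡ mayI t N
      mayI≡ i = P.trans (P.cong not (==-≢ λ t≡ → NP.<-irrefl t≡ (s≤s (NP.m≤m+n t i))))
                        (P.sym (P.cong not (==-≢ λ t≡N → NP.<-irrefl t≡N t<N)))

      low : ∑< t sided ≈ ∑< t whole + (cond (mayI t N) (a * ∑< t I₁) + cond (mayJ t N) (b * ∑< (t ∸ 1) J₁))
      low = begin
        ∑< t sided
          ≈⟨ ∑<-cong-≡ t (λ r r<t → P.trans (mergeSide-right F t N (take r δ) (drop r δ) (P.subst (_< t) (P.sym (|take| r r<t)) r<t))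
                                              (P.cong (λ m → merge (t ∸ m) (N ∸ m) (F (take r δ)) (drop r δ)) (|take| r r<t))) ⟩
        ∑< t (λ r → whole r + (cond (mayI (t ∸ r) (N ∸ r)) (a * I₁ r) + cond (mayJ (t ∸ r) (N ∸ r)) (b * J₁ r)))
          ≈⟨ trans (∑<-+ t whole _) (+-congˡ (∑<-+ t _ _)) ⟩
        ∑< t whole + (∑< t (λ r → cond (mayI (t ∸ r) (N ∸ r)) (a * I₁ r)) + ∑< t (λ r → cond (mayJ (t ∸ r) (N ∸ r)) (b * J₁ r)))
          ≈⟨ +-congˡ (+-cong (trans (∑<-cong-≡ t (λ r r<t → P.cong (λ c → cond (not c) (a * I₁ r)) (==-∸ t N r (NP.<⇒≤ r<t) (r≤N r<t))))
                                    (∑<-cond-* t (mayI t N) a I₁))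
                             (∑<-cond-mayJ t N J₁ 1≤t mayJ≡)) ⟩
        ∑< t whole + (cond (mayI t N) (a * ∑< t I₁) + cond (mayJ t N) (b * ∑< (t ∸ 1) J₁)) ∎
        where
        |take| : ∀ r → r < t → length (take r δ) ≡ r
        |take| r r<t = length-take-≤ r δ (NP.<⇒≤ (NP.<-trans r<t t<|δ|))
        r≤N : ∀ {r} → r < t → r ≤ N
        r≤N r<t = NP.<⇒≤ (NP.<-trans r<t t<N)
        mayJ≡ : ∀ r → suc r < t → mayJ (t ∸ r) (N ∸ r) ≡ mayJ t N
        mayJ≡ r r+1<t = P.cong₂ _∧_
          (P.trans (P.cong not (==-≢ t∸r≢1)) (P.sym (P.cong not (==-≢ λ t≡1 → NP.<-irrefl (P.sym t≡1) (NP.≤-trans (s≤s (s≤s z≤n)) r+1<t)))))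
          (P.cong not (==-∸ t N r (NP.<⇒≤ (NP.<⇒≤ r+1<t)) (NP.<⇒≤ (NP.<-trans (NP.<⇒≤ r+1<t) t<N))))
          where
          t∸r≢1 : t ∸ r ≢ 1
          t∸r≢1 t∸r≡1 = NP.<-irrefl (P.sym (P.trans (P.sym (NP.m+[n∸m]≡n (NP.<⇒≤ (NP.<⇒≤ r+1<t))))
                                                     (P.trans (P.cong (r N.+_) t∸r≡1) (NP.+-comm r 1)))) r+1<t

      high : ∑< (suc k) (λ i → sided (suc (t N.+ i))) ≈
             ∑< (suc k) whole⁺ + (cond (mayI t N) (a * ∑< (suc k) I₂) + cond (mayJ t N) (b * ∑< (suc k) J₂))
      high = begin
        ∑< (suc k) (λ i → sided (suc (t N.+ i)))
          ≈⟨ ∑<-cong-≡ (suc k) (λ i i<k+1 → P.trans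
               (mergeSide-left F t N (take (suc (t N.+ i)) δ) _ (P.subst (t <_) (P.sym (|take| i i<k+1)) (s≤s (NP.m≤m+n t i))))
               (P.cong (λ m → merge t m (λ d → F d (drop (suc (t N.+ i)) δ)) (take (suc (t N.+ i)) δ)) (|take| i i<k+1))) ⟩
        ∑< (suc k) (λ i → whole⁺ i + (cond (mayI t (suc (t N.+ i))) (a * I₂ i) + cond (mayJ t (suc (t N.+ i))) (b * J₂ i)))
          ≈⟨ trans (∑<-+ (suc k) whole⁺ _) (+-congˡ (∑<-+ (suc k) _ _)) ⟩
        ∑< (suc k) whole⁺ + (∑< (suc k) (λ i → cond (mayI t (suc (t N.+ i))) (a * I₂ i)) + ∑< (suc k) (λ i → cond (mayJ t (suc (t N.+ i))) (b * J₂ i)))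
          ≈⟨ +-congˡ (+-cong (trans (∑<-cong-≡ (suc k) (λ i _ → P.cong (λ c → cond c (a * I₂ i)) (mayI≡ i))) (∑<-cond-* (suc k) (mayI t N) a I₂))
                             (trans (∑<-cong-≡ (suc k) (λ i _ → P.cong (λ c → cond (not (t == 1) ∧ c) (b * J₂ i)) (mayI≡ i)))
                                    (∑<-cond-* (suc k) (mayJ t N) b J₂))) ⟩
        ∑< (suc k) whole⁺ + (cond (mayI t N) (a * ∑< (suc k) I₂) + cond (mayJ t N) (b * ∑< (suc k) J₂)) ∎
        where
        |take| : ∀ i → i < suc k → length (take (suc (t N.+ i)) δ) ≡ suc (t N.+ i)
        |take| i i<k+1 = length-take-≤ (suc (t N.+ i)) δ
          (P.subst (suc (t N.+ i) ≤_) (P.sym |δ|≡) (P.subst (_≤ t N.+ suc k) (NP.+-suc t i) (NP.+-monoʳ-≤ t i<k+1)))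

    merge-splitSum : merge t N (splitSum F) δ ≈ splitSum (mergeSide F t N) δ
    merge-splitSum = begin
      splitSum F δ + (cond (mayI t N) (a * splitSum F (down1 t δ)) + cond (mayJ t N) (b * splitSum F (down1 (t ∸ 1) (down1 t δ))))
        ≈⟨ +-cong (trans (reflexive (P.cong (λ n → ∑< (suc n) whole) |δ|≡)) (∑<-around t k whole))
                  (+-cong (cond-cong (mayI t N) (*-congˡ (splitSum-down1 F t δ k 1≤t |δ|≡))) (cond-mayJ-splitSum F t N δ k 1≤t |δ|≡)) ⟩
      (∑< t whole + (whole t + ∑< (suc k) whole⁺)) +
      (cond (mayI t N) (a * (∑< t I₁ + ∑< (suc k) I₂)) + cond (mayJ t N) (b * (∑< (t ∸ 1) J₁ + ∑< (suc k) J₂)))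
        ≈⟨ +-congˡ (+-cong (trans (cond-cong (mayI t N) (distribˡ a _ _)) (cond-+ (mayI t N) _ _))
                           (trans (cond-cong (mayJ t N) (distribˡ b _ _)) (cond-+ (mayJ t N) _ _))) ⟩
      (∑< t whole + (whole t + ∑< (suc k) whole⁺)) +
      ((cond (mayI t N) (a * ∑< t I₁) + cond (mayI t N) (a * ∑< (suc k) I₂)) +
       (cond (mayJ t N) (b * ∑< (t ∸ 1) J₁) + cond (mayJ t N) (b * ∑< (suc k) J₂)))
        ≈⟨ solve 7 (λ w₁ w₂ w₃ i₁ i₂ j₁ j₂ → (w₁ ⊕ (w₂ ⊕ w₃)) ⊕ ((i₁ ⊕ i₂) ⊕ (j₁ ⊕ j₂)) ⊜
                                            (w₁ ⊕ (i₁ ⊕ j₁)) ⊕ (w₂ ⊕ (w₃ ⊕ (i₂ ⊕ j₂)))) refl _ _ _ _ _ _ _ ⟩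
      (∑< t whole + (cond (mayI t N) (a * ∑< t I₁) + cond (mayJ t N) (b * ∑< (t ∸ 1) J₁))) +
      (whole t + (∑< (suc k) whole⁺ + (cond (mayI t N) (a * ∑< (suc k) I₂) + cond (mayJ t N) (b * ∑< (suc k) J₂))))
        ≈⟨ +-cong low (+-cong (reflexive (mergeSide-cut F t N (take t δ) (drop t δ) (length-take-≤ t δ (NP.<⇒≤ t<|δ|)))) high) ⟨
      ∑< t sided + (sided t + ∑< (suc k) (λ i → sided (suc (t N.+ i))))
        ≈⟨ trans (reflexive (P.cong (λ n → ∑< (suc n) sided) |δ|≡)) (∑<-around t k sided) ⟨
      splitSum (mergeSide F t N) δ ∎

  cutMergeAll : List ℕ → ℕ → (List ℕ → List ℕ → Carrier) → List ℕ → ℕ → Carrier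
  cutMergeAll T N F δ r = mergeAll (beforeCut r T) r (λ d₁ → mergeAll (afterCut r T) (N ∸ r) (F d₁) (drop r δ)) (take r δ)

  mergeAll-mergeSide-left : ∀ A M F t N r d₁ d₂ → t < length d₁ → t < r →
                            mergeAll A M (mergeSide F t N d₁) d₂ ≈ merge t r (λ d → mergeAll A M (F d) d₂) d₁
  mergeAll-mergeSide-left A M F t N r d₁ d₂ t<|d₁| t<r = begin
    mergeAll A M (mergeSide F t N d₁) d₂
      ≈⟨ mergeAll-cong A M (λ d → reflexive (mergeSide-left F t N d₁ d t<|d₁|)) d₂ ⟩
    mergeAll A M (λ d → merge t (length d₁) (λ d′ → F d′ d) d₁) d₂
      ≈⟨ mergeAll-linear A M (F d₁) (F (down1 t d₁)) (F (down1 (t ∸ 1) (down1 t d₁))) (mayI t (length d₁)) (mayJ t (length d₁)) (q - 1#) (- q) d₂ ⟩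
    mergeAll A M (F d₁) d₂ + (cond (mayI t (length d₁)) ((q - 1#) * mergeAll A M (F (down1 t d₁)) d₂)
                              + cond (mayJ t (length d₁)) ((- q) * mergeAll A M (F (down1 (t ∸ 1) (down1 t d₁))) d₂))
      ≡⟨ P.cong (λ c → mergeAll A M (F d₁) d₂ + (cond c ((q - 1#) * mergeAll A M (F (down1 t d₁)) d₂)
                         + cond (not (t == 1) ∧ c) ((- q) * mergeAll A M (F (down1 (t ∸ 1) (down1 t d₁))) d₂))) mayI≡ ⟩
    merge t r (λ d → mergeAll A M (F d) d₂) d₁ ∎
    where
    mayI≡ : mayI t (length d₁) ≡ mayI t r
    mayI≡ = P.trans (P.cong not (==-≢ λ t≡ → NP.<-irrefl t≡ t<|d₁|)) (P.sym (P.cong not (==-≢ λ t≡r → NP.<-irrefl t≡r t<r)))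

  cutMergeAll-mergeSide : ∀ t T N F δ r → All (suc (suc t) ≤_) T → 1 ≤ t → length δ ≡ N → r ≤ N →
                          cutMergeAll T N (mergeSide F t N) δ r ≈ cutMergeAll (t ∷ T) N F δ r
  cutMergeAll-mergeSide t T N F δ r t+2≤T 1≤t |δ|≡N r≤N with NP.<-cmp r t
  ... | tri< r<t _ _
    rewrite beforeCut-∷-> r t T r<t | beforeCut-[] r T (All.map (λ t+2≤u → NP.<-trans r<t (NP.<⇒≤ t+2≤u)) t+2≤T) | afterCut-∷-> r t T r<t =
    mergeAll-cong (afterCut r T) (N ∸ r) (λ d₂ → reflexive (P.trans
      (mergeSide-right F t N (take r δ) d₂ (P.subst (_< t) (P.sym |take|) r<t))
      (P.cong (λ m → merge (t ∸ m) (N ∸ m) (F (take r δ)) d₂) |take|))) (drop r δ)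
    where
    |take| : length (take r δ) ≡ r
    |take| = length-take-≤ r δ (P.subst (r ≤_) (P.sym |δ|≡N) r≤N)
  ... | tri≈ _ P.refl _
    rewrite beforeCut-∷-≤ t t T NP.≤-refl | beforeCut-[] t T (All.map NP.<⇒≤ t+2≤T) | afterCut-∷-≤ t t T NP.≤-refl =
    trans (mergeAll-cong (afterCut t T) (N ∸ t)
             (λ d₂ → reflexive (mergeSide-cut F t N (take t δ) d₂ (length-take-≤ t δ (P.subst (t ≤_) (P.sym |δ|≡N) r≤N)))) (drop t δ))
          (sym (merge-N t (λ d₁ → mergeAll (afterCut t T) (N ∸ t) (F d₁) (drop t δ)) (take t δ)))
  ... | tri> _ _ t<r rewrite beforeCut-∷-≤ r t T (NP.<⇒≤ t<r) | afterCut-∷-≤ r t T (NP.<⇒≤ t<r) =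
    mergeAll-cong-bounded (beforeCut r T) r t r (bfilter-All _ t+2≤T)
      (λ d₁ t<|d₁| _ → mergeAll-mergeSide-left (afterCut r T) (N ∸ r) F t N r d₁ (drop r δ) t<|d₁| t<r) (take r δ)
      (P.subst (t <_) (P.sym |take|) t<r) (NP.≤-reflexive |take|)
    where
    |take| : length (take r δ) ≡ r
    |take| = length-take-≤ r δ (P.subst (r ≤_) (P.sym |δ|≡N) r≤N)

  mergeAll-merge-splitSum : ∀ t T N F δ → All (suc (suc t) ≤_) T → All (_≤ N) T → 1 ≤ t → t ≤ N → length δ ≡ N →
                            mergeAll T N (merge t N (splitSum F)) δ ≈ mergeAll T N (splitSum (mergeSide F t N)) δ
  mergeAll-merge-splitSum t T N F δ t+2≤T T≤N 1≤t t≤N |δ|≡N with NP.m≤n⇒m<n∨m≡n t≤N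
  ... | inj₁ t<N = mergeAll-cong-bounded T N t N t+2≤T (λ d t<|d| |d|≤N → merge-splitSum F t N d 1≤t t<|d| |d|≤N) δ
                     (P.subst (t <_) (P.sym |δ|≡N) t<N) (NP.≤-reflexive |δ|≡N)
  mergeAll-merge-splitSum t (u ∷ T) N F δ (t+2≤u ∷ _) (u≤N ∷ _) _ _ _ | inj₂ P.refl =
    contradiction (NP.≤-trans t+2≤u u≤N) (NP.n≮n t ∘ NP.<⇒≤)
  mergeAll-merge-splitSum t [] N F δ _ _ _ _ |δ|≡N | inj₂ P.refl = begin
    merge t t (splitSum F) δ   ≈⟨ merge-N t (splitSum F) δ ⟩
    splitSum F δ               ≈⟨ ∑<-cong (suc (length δ)) (λ r r≤|δ| → sym (atCut r (NP.≤-pred r≤|δ|))) ⟩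
    splitSum (mergeSide F t t) δ ∎
    where
    atCut : ∀ r → r ≤ length δ → mergeSide F t t (take r δ) (drop r δ) ≈ F (take r δ) (drop r δ)
    atCut r r≤|δ| with NP.m≤n⇒m<n∨m≡n r≤|δ|
    ... | inj₁ r<|δ| = trans
      (reflexive (P.trans (mergeSide-right F t t (take r δ) (drop r δ) (P.subst (_< t) (P.sym |take|) (P.subst (r <_) |δ|≡N r<|δ|)))
                          (P.cong (λ m → merge (t ∸ m) (t ∸ m) (F (take r δ)) (drop r δ)) |take|)))
      (merge-N (t ∸ r) (F (take r δ)) (drop r δ))
      where |take| = length-take-≤ r δ r≤|δ|
    ... | inj₂ P.refl = reflexive (mergeSide-cut F t t (take r δ) (drop r δ) (P.trans (length-take-≤ r δ r≤|δ|) |δ|≡N))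

  -- Every merge acts on one side of each cut, which turns the splitting of δ into a cut-wise product.
  mergeAll-splitSum : ∀ T N F δ → Sparse T → All (1 ≤_) T → All (_≤ N) T → length δ ≡ N →
                      mergeAll T N (splitSum F) δ ≈ ∑< (suc N) (cutMergeAll T N F δ)
  mergeAll-splitSum []      N F δ _ _ _ |δ|≡N = reflexive (P.cong (λ n → ∑< (suc n) (λ r → F (take r δ) (drop r δ))) |δ|≡N)
  mergeAll-splitSum (t ∷ T) N F δ (t+2≤T , sparse) (1≤t ∷ 1≤T) (t≤N ∷ T≤N) |δ|≡N = begin
    mergeAll T N (merge t N (splitSum F)) δ      ≈⟨ mergeAll-merge-splitSum t T N F δ t+2≤T T≤N 1≤t t≤N |δ|≡N ⟩
    mergeAll T N (splitSum (mergeSide F t N)) δ  ≈⟨ mergeAll-splitSum T N (mergeSide F t N) δ sparse 1≤T T≤N |δ|≡N ⟩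
    ∑< (suc N) (cutMergeAll T N (mergeSide F t N) δ)
      ≈⟨ ∑<-cong (suc N) (λ r r≤N → cutMergeAll-mergeSide t T N F δ r t+2≤T 1≤t |δ|≡N (NP.≤-pred r≤N)) ⟩
    ∑< (suc N) (cutMergeAll (t ∷ T) N F δ) ∎

  mergeFactor : ℕ → ℕ → Carrier
  mergeFactor t N = 1# + (cond (mayI t N) (q - 1#) + cond (mayJ t N) (- q))

  mergeFactors : List ℕ → ℕ → Carrier
  mergeFactors []      N = 1#
  mergeFactors (t ∷ T) N = mergeFactors T N * mergeFactor t N

  mergeAll-invariant : ∀ T N (φ : List ℕ → Carrier) Y δ → (∀ t d → φ (down1 t d) ≡ φ d) →
                       mergeAll T N (λ d → φ d * Y) δ ≈ φ δ * (Y * mergeFactors T N)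
  mergeAll-invariant []      N φ Y δ φ-inv = *-congˡ (sym (*-identityʳ Y))
  mergeAll-invariant (t ∷ T) N φ Y δ φ-inv = begin
    mergeAll T N (merge t N (λ d → φ d * Y)) δ       ≈⟨ mergeAll-cong T N mergeφ δ ⟩
    mergeAll T N (λ d → φ d * (Y * mergeFactor t N)) δ ≈⟨ mergeAll-invariant T N φ (Y * mergeFactor t N) δ φ-inv ⟩
    φ δ * ((Y * mergeFactor t N) * mergeFactors T N)   ≈⟨ *-congˡ (trans (*-assoc _ _ _) (*-congˡ (*-comm _ _))) ⟩
    φ δ * (Y * mergeFactors (t ∷ T) N) ∎
    where
    mergeφ : ∀ d → merge t N (λ d → φ d * Y) d ≈ φ d * (Y * mergeFactor t N)
    mergeφ d rewrite φ-inv t d | φ-inv (t ∸ 1) (down1 t d) | φ-inv t d = begin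
      φ d * Y + (cond (mayI t N) ((q - 1#) * (φ d * Y)) + cond (mayJ t N) ((- q) * (φ d * Y)))
        ≈⟨ +-congˡ (+-cong (trans (cond-cong (mayI t N) (*-comm _ _)) (cond-*ˡ (mayI t N) _ _))
                           (trans (cond-cong (mayJ t N) (*-comm _ _)) (cond-*ˡ (mayJ t N) _ _))) ⟩
      φ d * Y + ((φ d * Y) * cond (mayI t N) (q - 1#) + (φ d * Y) * cond (mayJ t N) (- q))
        ≈⟨ trans (distribˡ _ _ _) (+-cong (*-identityʳ _) (distribˡ _ _ _)) ⟨
      (φ d * Y) * mergeFactor t N ≈⟨ *-assoc _ _ _ ⟩
      φ d * (Y * mergeFactor t N) ∎

  mergeFactor-last : ∀ t → mergeFactor t t ≈ 1#
  mergeFactor-last t rewrite ==-refl t | BP.∧-zeroʳ (not (t == 1)) = trans (+-congˡ (+-identityˡ 0#)) (+-identityʳ _)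

  mergeFactor-first : ∀ N → 1 < N → mergeFactor 1 N ≈ q
  mergeFactor-first N 1<N rewrite ==-≢ {1} {N} (λ 1≡N → NP.<-irrefl 1≡N 1<N) = begin
    1# + ((q - 1#) + 0#)  ≈⟨ +-congˡ (+-identityʳ _) ⟩
    1# + (q + - 1#)       ≈⟨ x∙yz≈y∙xz 1# q (- 1#) ⟩
    q + (1# + - 1#)       ≈⟨ +-congˡ (-‿inverseʳ 1#) ⟩
    q + 0#                ≈⟨ +-identityʳ q ⟩
    q ∎
    where open CommSemigroupProperties +-commutativeSemigroup using (x∙yz≈y∙xz)

  mergeFactor-middle : ∀ t N → 2 ≤ t → t < N → mergeFactor t N ≈ 0#
  mergeFactor-middle t N 2≤t t<N rewrite ==-≢ {t} {N} (λ t≡N → NP.<-irrefl t≡N t<N) | ==-≢ {t} {1} (λ t≡1 → NP.<-irrefl (P.sym t≡1) 2≤t) = begin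
    1# + ((q + - 1#) + - q)  ≈⟨ +-congˡ (xy∙z≈xz∙y q (- 1#) (- q)) ⟩
    1# + ((q + - q) + - 1#)  ≈⟨ +-congˡ (trans (+-congʳ (-‿inverseʳ q)) (+-identityˡ _)) ⟩
    1# + - 1#                ≈⟨ -‿inverseʳ 1# ⟩
    0# ∎
    where open CommSemigroupProperties +-commutativeSemigroup using (xy∙z≈xz∙y)

  -- Only the last letter of the prefix can change its run-end status, and its factor is 1.
  mergeFactors-take-runEnds : ∀ j r bs N → N ≡ j N.+ r →
    mergeFactors (positions (suc j) (take r (runEnds bs))) N ≈ mergeFactors (positions (suc j) (runEnds (take r bs))) N
  mergeFactors-take-runEnds j zero          bs       N _ = refl
  mergeFactors-take-runEnds j (suc r)       []       N _ = refl
  mergeFactors-take-runEnds j (suc zero)    (b ∷ bs) N P.refl = trans (single (b ∧ notHead bs)) (sym (single (b ∧ true)))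
    where
    single : ∀ c → mergeFactors (positions (suc j) (c ∷ [])) (j N.+ 1) ≈ 1#
    single true  rewrite NP.+-comm j 1 = trans (*-identityˡ _) (mergeFactor-last (suc j))
    single false = refl
  mergeFactors-take-runEnds j (suc (suc r)) (b ∷ bs) N N≡ rewrite notHead-take r bs with b ∧ notHead bs
  ... | true  = *-congʳ (mergeFactors-take-runEnds (suc j) (suc r) bs N (P.trans N≡ (NP.+-suc j (suc r))))
  ... | false = mergeFactors-take-runEnds (suc j) (suc r) bs N (P.trans N≡ (NP.+-suc j (suc r)))

  blockWeight : ℕ → List ℕ → Carrier
  blockWeight x d = cond (sum d == x) (weight (length d))

  blockWeight-down1 : ∀ x t d → blockWeight x (down1 t d) ≡ blockWeight x d
  blockWeight-down1 x t d = P.cong₂ (λ s w → cond (s == x) w) (sum-down1 t d) (weight-length t d)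
    where
    weight-length : ∀ t d → weight (length (down1 t d)) ≡ weight (length d)
    weight-length zero          d           = P.refl
    weight-length (suc zero)    []          = P.refl
    weight-length (suc zero)    (a ∷ [])    = P.refl
    weight-length (suc zero)    (a ∷ b ∷ d) = P.refl
    weight-length (suc (suc t)) []          = P.refl
    weight-length (suc (suc t)) (a ∷ d)     = P.refl

  η-∷-splitSum : ∀ x e δ → η δ (x ∷ e) ≈ splitSum (λ d₁ d₂ → blockWeight x d₁ * η d₂ e) δ
  η-∷-splitSum x e δ = trans (η-∷ δ x e) (∑<-cong (suc (length δ)) λ p p≤|δ| →
    trans (cond-*ʳ _ _ _) (*-congʳ (reflexive (P.cong (λ n → cond (sum (take p δ) == x) (weight n))
                                                        (P.sym (length-take-≤ p δ (NP.≤-pred p≤|δ|)))))))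

  wordTerm : List ℕ → Word → Carrier
  wordTerm e w = mergeAll (runEndPositions w) (length w) (λ δ → η δ e) (letters w)

  prefixWeight : ℕ → Word → Carrier
  prefixWeight x u = blockWeight x (letters u) * mergeFactors (runEndPositions u) (length u)

  cutMergeAll-wordTerm : ∀ x e w r → r ≤ length w →
    cutMergeAll (runEndPositions w) (length w) (λ d₁ d₂ → blockWeight x d₁ * η d₂ e) (letters w) r ≈
    prefixWeight x (take r w) * wordTerm e (drop r w)
  cutMergeAll-wordTerm x e w r r≤|w| = begin
    mergeAll (beforeCut r T) r (λ d₁ → mergeAll (afterCut r T) (N ∸ r) (λ d₂ → blockWeight x d₁ * η d₂ e) (drop r γ)) (take r γ)
      ≈⟨ mergeAll-cong (beforeCut r T) r (λ d₁ → mergeAll-* (afterCut r T) (N ∸ r) (blockWeight x d₁) (λ d₂ → η d₂ e) (drop r γ)) (take r γ) ⟩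
    mergeAll (beforeCut r T) r (λ d₁ → blockWeight x d₁ * Y) (take r γ)
      ≈⟨ mergeAll-invariant (beforeCut r T) r (blockWeight x) Y (take r γ) (blockWeight-down1 x) ⟩
    blockWeight x (take r γ) * (Y * mergeFactors (beforeCut r T) r)
      ≈⟨ *-congˡ (*-cong Y≈ factors≈) ⟩
    blockWeight x (take r γ) * (wordTerm e (drop r w) * mergeFactors (runEndPositions (take r w)) (length (take r w)))
      ≡⟨ P.cong (λ d → blockWeight x d * (wordTerm e (drop r w) * mergeFactors (runEndPositions (take r w)) (length (take r w))))
                (LP.take-map r w) ⟩
    blockWeight x (letters (take r w)) * (wordTerm e (drop r w) * mergeFactors (runEndPositions (take r w)) (length (take r w)))
      ≈⟨ trans (*-congˡ (*-comm _ _)) (sym (*-assoc _ _ _)) ⟩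
    prefixWeight x (take r w) * wordTerm e (drop r w) ∎
    where
    T = runEndPositions w
    N = length w
    γ = letters w
    Y = mergeAll (afterCut r T) (N ∸ r) (λ δ → η δ e) (drop r γ)
    Y≈ : Y ≈ wordTerm e (drop r w)
    Y≈ = reflexive (P.trans (P.cong₂ (λ U n → mergeAll U n (λ δ → η δ e) (drop r γ)) (afterCut-runEndPositions r w) (P.sym (LP.length-drop r w)))
                            (P.cong (mergeAll (runEndPositions (drop r w)) (length (drop r w)) (λ δ → η δ e)) (LP.drop-map r w)))
    factors≈ : mergeFactors (beforeCut r T) r ≈ mergeFactors (runEndPositions (take r w)) (length (take r w))
    factors≈ = trans (reflexive (P.cong (λ U → mergeFactors U r) (beforeCut-runEndPositions r w)))
                     (trans (mergeFactors-take-runEnds 0 r (flags w) r P.refl)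
                            (reflexive (P.cong₂ (λ bs n → mergeFactors (positions 1 (runEnds bs)) n) (LP.take-map r w) (P.sym (length-take-≤ r w r≤|w|)))))

  wordTerm-∷ : ∀ x e w → wordTerm (x ∷ e) w ≈ ∑< (suc (length w)) (λ r → prefixWeight x (take r w) * wordTerm e (drop r w))
  wordTerm-∷ x e w = begin
    mergeAll T N (λ δ → η δ (x ∷ e)) γ   ≈⟨ mergeAll-cong T N (η-∷-splitSum x e) γ ⟩
    mergeAll T N (splitSum F) γ          ≈⟨ mergeAll-splitSum T N F γ (runEnds-sparse 1 (flags w)) (positions-≥ 1 (runEnds (flags w)))
                                                               (runEndPositions-≤ w) (LP.length-map proj₁ w) ⟩
    ∑< (suc N) (cutMergeAll T N F γ)     ≈⟨ ∑<-cong (suc N) (λ r r<N+1 → cutMergeAll-wordTerm x e w r (NP.≤-pred r<N+1)) ⟩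
    ∑< (suc N) (λ r → prefixWeight x (take r w) * wordTerm e (drop r w)) ∎
    where
    T = runEndPositions w
    N = length w
    γ = letters w
    F : List ℕ → List ℕ → Carrier
    F d₁ d₂ = blockWeight x d₁ * η d₂ e

  splitSum-∷ : {A : Set} (F : List A → List A → Carrier) (c : A) (w : List A) → splitSum F (c ∷ w) ≈ F [] (c ∷ w) + splitSum (λ u v → F (c ∷ u) v) w
  splitSum-∷ F c w = ∑<-suc (suc (length w)) _

  splitSum-tagged : ∀ F b xs → splitSum F (tagged b xs) ≈ ∑< (suc (length xs)) (λ r → F (tagged b (take r xs)) (tagged b (drop r xs)))
  splitSum-tagged F b xs = trans (reflexive (P.cong (λ n → ∑< (suc n) (λ r → F (take r (tagged b xs)) (drop r (tagged b xs)))) (LP.length-map _ xs)))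
                                 (∑<-cong-≡ (suc (length xs)) (λ r _ → P.cong₂ F (LP.take-map r xs) (LP.drop-map r xs)))

  ∑-∷-shuffles : ∀ (g : Word → Carrier) x xs y ys →
    ∑ g (shuffles (x ∷ xs) (y ∷ ys)) ≈ ∑ (λ u → g ((x , false) ∷ u)) (shuffles xs (y ∷ ys)) + ∑ (λ u → g ((y , true) ∷ u)) (shuffles (x ∷ xs) ys)
  ∑-∷-shuffles g x xs y ys = trans (∑-++ g (map ((x , false) ∷_) (shuffles xs (y ∷ ys))) (map ((y , true) ∷_) (shuffles (x ∷ xs) ys)))
                                   (+-cong (reflexive (∑-map g _ (shuffles xs (y ∷ ys)))) (reflexive (∑-map g _ (shuffles (x ∷ xs) ys))))

  shuffleCut : (Word → Word → Carrier) → List ℕ → List ℕ → ℕ → ℕ → Carrier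
  shuffleCut F α β p s = ∑ (λ u → ∑ (F u) (shuffles (drop p α) (drop s β))) (shuffles (take p α) (take s β))

  module _ (F : Word → Word → Carrier) (x : ℕ) (xs : List ℕ) (y : ℕ) (ys : List ℕ) where

    private
      Fα : Word → Word → Carrier
      Fα u v = F ((x , false) ∷ u) v
      Fβ : Word → Word → Carrier
      Fβ u v = F ((y , true) ∷ u) v

    shuffleCut-0-0 : shuffleCut F (x ∷ xs) (y ∷ ys) 0 0 ≈
                     ∑ (λ w → F [] ((x , false) ∷ w)) (shuffles xs (y ∷ ys)) + ∑ (λ w → F [] ((y , true) ∷ w)) (shuffles (x ∷ xs) ys)
    shuffleCut-0-0 = trans (∑-[-] _ []) (∑-∷-shuffles (F []) x xs y ys)

    shuffleCut-0-suc : ∀ s → shuffleCut F (x ∷ xs) (y ∷ ys) 0 (suc s) ≈ shuffleCut Fβ (x ∷ xs) ys 0 s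
    shuffleCut-0-suc s = trans (∑-[-] _ _) (sym (∑-[-] _ _))

    shuffleCut-suc-0 : ∀ p → shuffleCut F (x ∷ xs) (y ∷ ys) (suc p) 0 ≈ shuffleCut Fα xs (y ∷ ys) p 0
    shuffleCut-suc-0 p = trans (∑-[-] _ _) (sym (trans (reflexive (P.cong (∑ (λ u → ∑ (Fα u) (shuffles (drop p xs) (y ∷ ys)))) (shuffles-[] (take p xs))))
                                                       (∑-[-] _ _)))

    shuffleCut-suc-suc : ∀ p s → shuffleCut F (x ∷ xs) (y ∷ ys) (suc p) (suc s) ≈
                                 shuffleCut Fα xs (y ∷ ys) p (suc s) + shuffleCut Fβ (x ∷ xs) ys (suc p) s
    shuffleCut-suc-suc p s = ∑-∷-shuffles _ x (take p xs) y (take s ys)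

  -- A shuffle of α and β cut after r letters is a shuffle of the first p letters of α and the first s letters of β,
  -- followed by a shuffle of the remaining letters, for a unique split p + s = r.
  ∑-shuffles-splitSum : ∀ α β F → ∑ (splitSum F) (shuffles α β) ≈ ∑< (suc (length α)) (λ p → ∑< (suc (length β)) (shuffleCut F α β p))
  ∑-shuffles-splitSum [] β F = begin
    ∑ (splitSum F) (tagged true β ∷ [])     ≈⟨ ∑-[-] (splitSum F) _ ⟩
    splitSum F (tagged true β)               ≈⟨ splitSum-tagged F true β ⟩
    ∑< (suc (length β)) (λ s → F (tagged true (take s β)) (tagged true (drop s β)))
      ≈⟨ ∑<-cong (suc (length β)) (λ s _ → sym (trans (∑-[-] _ _) (∑-[-] _ _))) ⟩
    ∑< (suc (length β)) (shuffleCut F [] β 0) ≈⟨ ∑<-1 _ ⟨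
    ∑< 1 (λ p → ∑< (suc (length β)) (shuffleCut F [] β p)) ∎
  ∑-shuffles-splitSum (x ∷ xs) [] F = begin
    ∑ (splitSum F) (tagged false (x ∷ xs) ∷ []) ≈⟨ ∑-[-] (splitSum F) _ ⟩
    splitSum F (tagged false (x ∷ xs))           ≈⟨ splitSum-tagged F false (x ∷ xs) ⟩
    ∑< (suc (length (x ∷ xs))) (λ p → F (tagged false (take p (x ∷ xs))) (tagged false (drop p (x ∷ xs))))
      ≈⟨ ∑<-cong (suc (length (x ∷ xs))) (λ p _ → sym (trans (∑<-1 _) (trans
           (reflexive (P.cong₂ (λ A B → ∑ (λ u → ∑ (F u) A) B) (shuffles-[] (drop p (x ∷ xs))) (shuffles-[] (take p (x ∷ xs)))))
           (trans (∑-[-] _ _) (∑-[-] _ _))))) ⟩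
    ∑< (suc (length (x ∷ xs))) (λ p → ∑< 1 (shuffleCut F (x ∷ xs) [] p)) ∎
  ∑-shuffles-splitSum (x ∷ xs) (y ∷ ys) F = begin
    ∑ (splitSum F) (shuffles (x ∷ xs) (y ∷ ys))
      ≈⟨ ∑-∷-shuffles (splitSum F) x xs y ys ⟩
    ∑ (λ w → splitSum F (a ∷ w)) Wa + ∑ (λ w → splitSum F (b ∷ w)) Wb
      ≈⟨ +-cong (trans (∑-cong (splitSum-∷ F a) Wa) (∑-+ _ _ Wa)) (trans (∑-cong (splitSum-∷ F b) Wb) (∑-+ _ _ Wb)) ⟩
    (Ea + ∑ (splitSum Fa) Wa) + (Eb + ∑ (splitSum Fb) Wb)
      ≈⟨ +-cong (+-congˡ (∑-shuffles-splitSum xs (y ∷ ys) Fa)) (+-congˡ (∑-shuffles-splitSum (x ∷ xs) ys Fb)) ⟩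
    (Ea + ∑< (suc n) (λ p → ∑< (suc (suc m)) (Ca p))) + (Eb + ∑< (suc (suc n)) (λ p → ∑< (suc m) (Cb p)))
      ≈⟨ +-cong (+-congˡ (∑<-cong (suc n) (λ p _ → ∑<-suc (suc m) (Ca p)))) (+-congˡ (∑<-suc (suc n) _)) ⟩
    (Ea + ∑< (suc n) (λ p → Ca p 0 + ∑< (suc m) (λ s → Ca p (suc s)))) + (Eb + (∑< (suc m) (Cb 0) + ∑< (suc n) (λ p → ∑< (suc m) (Cb (suc p)))))
      ≈⟨ +-cong (+-congˡ (∑<-+ (suc n) _ _)) refl ⟩
    (Ea + (∑< (suc n) (λ p → Ca p 0) + ∑< (suc n) (λ p → ∑< (suc m) (λ s → Ca p (suc s)))))
      + (Eb + (∑< (suc m) (Cb 0) + ∑< (suc n) (λ p → ∑< (suc m) (Cb (suc p)))))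
      ≈⟨ solve 6 (λ ea ca₀ ca eb cb₀ cb → (ea ⊕ (ca₀ ⊕ ca)) ⊕ (eb ⊕ (cb₀ ⊕ cb)) ⊜ ((ea ⊕ eb) ⊕ cb₀) ⊕ (ca₀ ⊕ (ca ⊕ cb)))
                 refl _ _ _ _ _ _ ⟩
    ((Ea + Eb) + ∑< (suc m) (Cb 0))
      + (∑< (suc n) (λ p → Ca p 0) + (∑< (suc n) (λ p → ∑< (suc m) (λ s → Ca p (suc s))) + ∑< (suc n) (λ p → ∑< (suc m) (Cb (suc p)))))
      ≈⟨ +-cong (+-cong (sym (shuffleCut-0-0 F x xs y ys)) (∑<-cong (suc m) (λ s _ → sym (shuffleCut-0-suc F x xs y ys s))))
                (+-cong (∑<-cong (suc n) (λ p _ → sym (shuffleCut-suc-0 F x xs y ys p)))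
                        (trans (sym (∑<-+ (suc n) _ _)) (∑<-cong (suc n) (λ p _ → trans (sym (∑<-+ (suc m) _ _))
                                                                            (∑<-cong (suc m) (λ s _ → sym (shuffleCut-suc-suc F x xs y ys p s))))))) ⟩
    (shuffleCut F α β 0 0 + ∑< (suc m) (shuffleCut F α β 0 ∘ suc))
      + (∑< (suc n) (λ p → shuffleCut F α β (suc p) 0) + ∑< (suc n) (λ p → ∑< (suc m) (shuffleCut F α β (suc p) ∘ suc)))
      ≈⟨ +-cong (sym (∑<-suc (suc m) _)) (trans (sym (∑<-+ (suc n) _ _)) (∑<-cong (suc n) (λ p _ → sym (∑<-suc (suc m) _)))) ⟩
    ∑< (suc (suc m)) (shuffleCut F α β 0) + ∑< (suc n) (λ p → ∑< (suc (suc m)) (shuffleCut F α β (suc p)))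
      ≈⟨ ∑<-suc (suc n) _ ⟨
    ∑< (suc (suc n)) (λ p → ∑< (suc (suc m)) (shuffleCut F α β p)) ∎
    where
    α = x ∷ xs
    β = y ∷ ys
    n = length xs
    m = length ys
    a = (x , false)
    b = (y , true)
    Wa = shuffles xs (y ∷ ys)
    Wb = shuffles (x ∷ xs) ys
    Fa : Word → Word → Carrier
    Fa u v = F (a ∷ u) v
    Fb : Word → Word → Carrier
    Fb u v = F (b ∷ u) v
    Ea = ∑ (λ w → F [] (a ∷ w)) Wa
    Eb = ∑ (λ w → F [] (b ∷ w)) Wb
    Ca = shuffleCut Fa xs (y ∷ ys)
    Cb = shuffleCut Fb (x ∷ xs) ys

  shuffleFactor : ℕ → ℕ → Carrier
  shuffleFactor zero    s       = 1#
  shuffleFactor (suc p) zero    = 1#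
  shuffleFactor (suc p) (suc s) = q + 1#

  weight-shuffleFactor : ∀ p s → weight (p N.+ s) * shuffleFactor p s ≈ weight p * weight s
  weight-shuffleFactor zero    s       = trans (*-identityʳ _) (sym (*-identityˡ _))
  weight-shuffleFactor (suc p) zero    = refl
  weight-shuffleFactor (suc p) (suc s) = refl

  mergeFactors-α : ∀ j N xs → mergeFactors (positions j (runEnds (flags (tagged false xs)))) N ≈ 1#
  mergeFactors-α j N []       = refl
  mergeFactors-α j N (x ∷ xs) = mergeFactors-α (suc j) N xs

  mergeFactors-β : ∀ j ys N → N ≡ j N.+ length ys → mergeFactors (positions (suc j) (runEnds (flags (tagged true ys)))) N ≈ 1#
  mergeFactors-β j []            N _    = refl
  mergeFactors-β j (y ∷ [])      N N≡ = trans (*-identityˡ _) (trans (reflexive (P.cong (mergeFactor (suc j)) (P.trans N≡ (NP.+-comm j 1))))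
                                                                       (mergeFactor-last (suc j)))
  mergeFactors-β j (y ∷ y′ ∷ ys) N N≡ = mergeFactors-β (suc j) (y′ ∷ ys) N (P.trans N≡ (NP.+-suc j _))

  ∑-mergeFactors-β-middle : ∀ k x xs ys N → N ≡ suc (suc k) N.+ (suc (length xs) N.+ length ys) →
    ∑ (λ u → mergeFactors (positions (suc (suc k)) ((true ∧ notHead (flags u)) ∷ runEnds (flags u))) N) (shuffles (x ∷ xs) ys) ≈ 0#
  ∑-mergeFactors-β-middle k x xs []          N N≡ = trans (∑-[-] _ _) (trans (*-congˡ (mergeFactor-middle (suc (suc k)) N (s≤s (s≤s z≤n)) k+2<N)) (zeroʳ _))
    where
    k+2<N : suc (suc k) < N
    k+2<N rewrite N≡ | NP.+-suc (suc (suc k)) (length xs N.+ 0) = s≤s (NP.m≤m+n (suc (suc k)) _)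
  ∑-mergeFactors-β-middle k x xs (y′ ∷ ys′) N N≡ = begin
    ∑ g (shuffles (x ∷ xs) (y′ ∷ ys′))
      ≈⟨ ∑-∷-shuffles g x xs y′ ys′ ⟩
    ∑ (λ u → g ((x , false) ∷ u)) (shuffles xs (y′ ∷ ys′)) + ∑ (λ u → g ((y′ , true) ∷ u)) (shuffles (x ∷ xs) ys′)
      ≈⟨ +-cong (trans (∑-cong (λ u → trans (*-congˡ (mergeFactor-middle (suc (suc k)) N (s≤s (s≤s z≤n)) k+2<N)) (zeroʳ _)) _) (∑-0 _))
                (∑-mergeFactors-β-middle (suc k) x xs ys′ N (P.trans N≡ (P.trans (P.cong (suc (suc k) N.+_) (NP.+-suc (suc (length xs)) (length ys′)))
                                                                                 (NP.+-suc (suc (suc k)) _)))) ⟩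
    0# + 0#  ≈⟨ +-identityʳ 0# ⟩
    0# ∎
    where
    g = λ u → mergeFactors (positions (suc (suc k)) ((true ∧ notHead (flags u)) ∷ runEnds (flags u))) N
    k+2<N : suc (suc k) < N
    k+2<N rewrite N≡ | NP.+-suc (suc (suc k)) (length xs N.+ suc (length ys′)) = s≤s (NP.m≤m+n (suc (suc k)) _)

  ∑-mergeFactors-after : ∀ k xs ys N → N ≡ suc k N.+ (length xs N.+ length ys) →
    ∑ (λ u → mergeFactors (positions (suc (suc k)) (runEnds (flags u))) N) (shuffles xs ys) ≈ 1#
  ∑-mergeFactors-after k []       ys       N N≡ = trans (∑-[-] _ _) (mergeFactors-β (suc k) ys N N≡)
  ∑-mergeFactors-after k (x ∷ xs) []       N N≡ = trans (∑-[-] _ _) (mergeFactors-α (suc (suc k)) N (x ∷ xs))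
  ∑-mergeFactors-after k (x ∷ xs) (y ∷ ys) N N≡ = begin
    ∑ g (shuffles (x ∷ xs) (y ∷ ys))
      ≈⟨ ∑-∷-shuffles g x xs y ys ⟩
    ∑ (λ u → g ((x , false) ∷ u)) (shuffles xs (y ∷ ys)) + ∑ (λ u → g ((y , true) ∷ u)) (shuffles (x ∷ xs) ys)
      ≈⟨ +-cong (∑-mergeFactors-after (suc k) xs (y ∷ ys) N (P.trans N≡ (NP.+-suc (suc k) _)))
                (∑-mergeFactors-β-middle k x xs ys N (P.trans N≡ (P.trans (P.cong (suc k N.+_) (NP.+-suc (suc (length xs)) (length ys))) (NP.+-suc (suc k) _)))) ⟩
    1# + 0#  ≈⟨ +-identityʳ 1# ⟩
    1# ∎
    where
    g = λ u → mergeFactors (positions (suc (suc k)) (runEnds (flags u))) N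

  ∑-mergeFactors-β-first : ∀ x xs ys N → N ≡ 1 N.+ (suc (length xs) N.+ length ys) →
    ∑ (λ u → mergeFactors (positions 1 ((true ∧ notHead (flags u)) ∷ runEnds (flags u))) N) (shuffles (x ∷ xs) ys) ≈ q
  ∑-mergeFactors-β-first x xs []          N N≡ = trans (∑-[-] _ _) (trans (*-congʳ (mergeFactors-α 2 N (x ∷ xs)))
                                                                          (trans (*-identityˡ _) (mergeFactor-first N 1<N)))
    where
    1<N : 1 < N
    1<N rewrite N≡ = s≤s (s≤s z≤n)
  ∑-mergeFactors-β-first x xs (y′ ∷ ys′) N N≡ = begin
    ∑ g (shuffles (x ∷ xs) (y′ ∷ ys′))
      ≈⟨ ∑-∷-shuffles g x xs y′ ys′ ⟩
    ∑ (λ u → g ((x , false) ∷ u)) (shuffles xs (y′ ∷ ys′)) + ∑ (λ u → g ((y′ , true) ∷ u)) (shuffles (x ∷ xs) ys′)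
      ≈⟨ +-cong (trans (sym (∑-*ʳ (mergeFactor 1 N) _ (shuffles xs (y′ ∷ ys′))))
                       (trans (*-congʳ (∑-mergeFactors-after 1 xs (y′ ∷ ys′) N N≡)) (trans (*-identityˡ _) (mergeFactor-first N 1<N))))
                (∑-mergeFactors-β-middle 0 x xs ys′ N (P.trans N≡ (P.cong suc (NP.+-suc (suc (length xs)) (length ys′))))) ⟩
    q + 0#  ≈⟨ +-identityʳ q ⟩
    q ∎
    where
    g = λ u → mergeFactors (positions 1 ((true ∧ notHead (flags u)) ∷ runEnds (flags u))) N
    1<N : 1 < N
    1<N rewrite N≡ = s≤s (s≤s z≤n)

  -- Merge factors are 1 at t = N, q at t = 1 and 0 in between, so only two shuffles contribute:
  -- β at the end (1), and the first letter of β in front with the rest at the end (q).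
  ∑-mergeFactors-shuffles : ∀ xs ys → ∑ (λ u → mergeFactors (runEndPositions u) (length xs N.+ length ys)) (shuffles xs ys) ≈
                                      shuffleFactor (length xs) (length ys)
  ∑-mergeFactors-shuffles []       ys       = trans (∑-[-] _ _) (mergeFactors-β 0 ys (length ys) P.refl)
  ∑-mergeFactors-shuffles (x ∷ xs) []       = trans (∑-[-] _ _) (mergeFactors-α 1 _ (x ∷ xs))
  ∑-mergeFactors-shuffles (x ∷ xs) (y ∷ ys) = begin
    ∑ g (shuffles (x ∷ xs) (y ∷ ys))
      ≈⟨ ∑-∷-shuffles g x xs y ys ⟩
    ∑ (λ u → g ((x , false) ∷ u)) (shuffles xs (y ∷ ys)) + ∑ (λ u → g ((y , true) ∷ u)) (shuffles (x ∷ xs) ys)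
      ≈⟨ +-cong (∑-mergeFactors-after 0 xs (y ∷ ys) N P.refl) (∑-mergeFactors-β-first x xs ys N (P.cong suc (NP.+-suc (length xs) (length ys)))) ⟩
    1# + q  ≈⟨ +-comm 1# q ⟩
    q + 1# ∎
    where
    N = length (x ∷ xs) N.+ length (y ∷ ys)
    g = λ u → mergeFactors (runEndPositions u) N

  ∑-prefixWeight-shuffles : ∀ x xs ys → ∑ (prefixWeight x) (shuffles xs ys) ≈
                                        cond ((sum xs N.+ sum ys) == x) (weight (length xs) * weight (length ys))
  ∑-prefixWeight-shuffles x xs ys = begin
    ∑ (prefixWeight x) (shuffles xs ys)
      ≈⟨ ∑-congᴬ (λ u → uniform u) (All.zip (sum-shuffles xs ys , length-shuffles xs ys)) ⟩
    ∑ (λ u → cond (S == x) (weight n) * mergeFactors (runEndPositions u) n) (shuffles xs ys)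
      ≈⟨ ∑-*ˡ _ _ (shuffles xs ys) ⟨
    cond (S == x) (weight n) * ∑ (λ u → mergeFactors (runEndPositions u) n) (shuffles xs ys)
      ≈⟨ *-congˡ (∑-mergeFactors-shuffles xs ys) ⟩
    cond (S == x) (weight n) * shuffleFactor (length xs) (length ys)
      ≈⟨ cond-*ʳ (S == x) _ _ ⟨
    cond (S == x) (weight n * shuffleFactor (length xs) (length ys))
      ≈⟨ cond-cong (S == x) (weight-shuffleFactor (length xs) (length ys)) ⟩
    cond (S == x) (weight (length xs) * weight (length ys)) ∎
    where
    S = sum xs N.+ sum ys
    n = length xs N.+ length ys
    uniform : ∀ u → (sum (letters u) ≡ S) × (length u ≡ n) → prefixWeight x u ≈ cond (S == x) (weight n) * mergeFactors (runEndPositions u) n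
    uniform u (sum≡ , |u|≡) rewrite P.sym |u|≡ | P.sym sum≡ =
      reflexive (P.cong (λ l → cond (sum (letters u) == x) (weight l) * mergeFactors (runEndPositions u) (length u)) (LP.length-map proj₁ u))

  -- Both sides satisfy the same recursion in the number of variables

  shuffleSum : List ℕ → List ℕ → Series
  shuffleSum α β e = ∑ (wordTerm e) (shuffles α β)

  shuffleSum-∷ : ∀ α β x e → shuffleSum α β (x ∷ e) ≈
    ∑< (suc (length α)) (λ p → ∑< (suc (length β)) (λ s →
      cond ((sum (take p α) N.+ sum (take s β)) == x) (weight p * weight s * shuffleSum (drop p α) (drop s β) e)))
  shuffleSum-∷ α β x e = begin
    ∑ (wordTerm (x ∷ e)) (shuffles α β)   ≈⟨ ∑-cong (wordTerm-∷ x e) (shuffles α β) ⟩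
    ∑ (splitSum F) (shuffles α β)         ≈⟨ ∑-shuffles-splitSum α β F ⟩
    ∑< (suc (length α)) (λ p → ∑< (suc (length β)) (shuffleCut F α β p))
      ≈⟨ ∑<-cong (suc (length α)) (λ p p<|α|+1 → ∑<-cong (suc (length β)) (λ s s<|β|+1 → cut p s (NP.≤-pred p<|α|+1) (NP.≤-pred s<|β|+1))) ⟩
    ∑< (suc (length α)) (λ p → ∑< (suc (length β)) (λ s →
      cond ((sum (take p α) N.+ sum (take s β)) == x) (weight p * weight s * shuffleSum (drop p α) (drop s β) e))) ∎
    where
    F : Word → Word → Carrier
    F u v = prefixWeight x u * wordTerm e v
    cut : ∀ p s → p ≤ length α → s ≤ length β → shuffleCut F α β p s ≈
          cond ((sum (take p α) N.+ sum (take s β)) == x) (weight p * weight s * shuffleSum (drop p α) (drop s β) e)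
    cut p s p≤|α| s≤|β| = begin
      ∑ (λ u → ∑ (F u) (shuffles (drop p α) (drop s β))) (shuffles (take p α) (take s β))
        ≈⟨ ∑-cong (λ u → sym (∑-*ˡ (prefixWeight x u) (wordTerm e) (shuffles (drop p α) (drop s β)))) (shuffles (take p α) (take s β)) ⟩
      ∑ (λ u → prefixWeight x u * shuffleSum (drop p α) (drop s β) e) (shuffles (take p α) (take s β))
        ≈⟨ ∑-*ʳ _ (prefixWeight x) (shuffles (take p α) (take s β)) ⟨
      ∑ (prefixWeight x) (shuffles (take p α) (take s β)) * shuffleSum (drop p α) (drop s β) e
        ≈⟨ *-congʳ (∑-prefixWeight-shuffles x (take p α) (take s β)) ⟩
      cond ((sum (take p α) N.+ sum (take s β)) == x) (weight (length (take p α)) * weight (length (take s β))) * shuffleSum (drop p α) (drop s β) e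
        ≡⟨ P.cong₂ (λ m n → cond ((sum (take p α) N.+ sum (take s β)) == x) (weight m * weight n) * shuffleSum (drop p α) (drop s β) e)
                   (length-take-≤ p α p≤|α|) (length-take-≤ s β s≤|β|) ⟩
      cond ((sum (take p α) N.+ sum (take s β)) == x) (weight p * weight s) * shuffleSum (drop p α) (drop s β) e
        ≈⟨ cond-*ʳ _ _ _ ⟨
      cond ((sum (take p α) N.+ sum (take s β)) == x) (weight p * weight s * shuffleSum (drop p α) (drop s β) e) ∎

  wordTerm-[] : ∀ w → wordTerm [] w ≈ cond (null w) (mergeFactors (runEndPositions w) (length w))
  wordTerm-[] w = begin
    mergeAll T N (λ δ → η δ []) (letters w)
      ≈⟨ mergeAll-cong T N (λ δ → trans (η-[] δ) (sym (*-identityʳ _))) (letters w) ⟩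
    mergeAll T N (λ δ → cond (null δ) 1# * 1#) (letters w)
      ≈⟨ mergeAll-invariant T N (λ δ → cond (null δ) 1#) 1# (letters w) (λ t δ → P.cong (λ b → cond b 1#) (null-down1 t δ)) ⟩
    cond (null (letters w)) 1# * (1# * mergeFactors T N)
      ≈⟨ trans (*-congˡ (*-identityˡ _)) (sym (cond-*ʳ (null (letters w)) 1# _)) ⟩
    cond (null (letters w)) (1# * mergeFactors T N)
      ≈⟨ reflexive (P.cong₂ cond (null-letters w) P.refl) ⟩
    cond (null w) (1# * mergeFactors T N)
      ≈⟨ cond-cong (null w) (*-identityˡ _) ⟩
    cond (null w) (mergeFactors T N) ∎
    where
    T = runEndPositions w
    N = length w
    null-letters : ∀ w → null (letters w) ≡ null w
    null-letters []      = P.refl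
    null-letters (_ ∷ _) = P.refl

  shuffleSum-[]-nonempty : ∀ α β k → length α N.+ length β ≡ suc k → shuffleSum α β [] ≈ 0#
  shuffleSum-[]-nonempty α β k |α|+|β|≡ =
    trans (∑-congᴬ (λ w |w|≡ → vanish w (P.trans |w|≡ |α|+|β|≡)) (length-shuffles α β)) (∑-0 (shuffles α β))
    where
    vanish : ∀ w → length w ≡ suc k → wordTerm [] w ≈ 0#
    vanish (l ∷ w) _ = wordTerm-[] (l ∷ w)

  ⊗-η-[] : ∀ α β → (η α ⊗ η β) [] ≈ shuffleSum α β []
  ⊗-η-[] α β = trans (reflexive (⊗-∑ (η α) (η β) [])) (trans (∑-[-] _ []) (trans (*-cong (η-[] α) (η-[] β)) (cases α β)))
    where
    cases : ∀ α β → cond (null α) 1# * cond (null β) 1# ≈ shuffleSum α β []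
    cases []      []      = trans (*-identityˡ 1#) (sym (trans (∑-[-] _ []) (wordTerm-[] [])))
    cases (a ∷ α) β       = trans (zeroˡ _) (sym (shuffleSum-[]-nonempty (a ∷ α) β _ P.refl))
    cases []      (b ∷ β) = trans (zeroʳ _) (sym (shuffleSum-[]-nonempty [] (b ∷ β) _ P.refl))

  ⊗-η≈shuffleSum : ∀ e α β → (η α ⊗ η β) e ≈ shuffleSum α β e
  ⊗-η≈shuffleSum []      α β = ⊗-η-[] α β
  ⊗-η≈shuffleSum (x ∷ e) α β = begin
    (η α ⊗ η β) (x ∷ e)
      ≈⟨ ⊗-η-∷ α β x e ⟩
    ∑< (suc (length α)) (λ p → ∑< (suc (length β)) (λ s →
      cond ((sum (take p α) N.+ sum (take s β)) == x) (weight p * weight s * (η (drop p α) ⊗ η (drop s β)) e)))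
      ≈⟨ ∑<-cong (suc (length α)) (λ p _ → ∑<-cong (suc (length β)) (λ s _ →
           cond-cong ((sum (take p α) N.+ sum (take s β)) == x) (*-congˡ (⊗-η≈shuffleSum e (drop p α) (drop s β))))) ⟩
    ∑< (suc (length α)) (λ p → ∑< (suc (length β)) (λ s →
      cond ((sum (take p α) N.+ sum (take s β)) == x) (weight p * weight s * shuffleSum (drop p α) (drop s β) e)))
      ≈⟨ shuffleSum-∷ α β x e ⟨
    shuffleSum α β (x ∷ e) ∎

  rhs≈shuffleSum : ∀ α β e → rhs α β e ≈ shuffleSum α β e
  rhs≈shuffleSum α β e = begin
    rhs α β e
      ≈⟨ trans (reflexive (rsum-map _ (Sh α β)))
               (∑-cong (λ γS → trans (reflexive (rsum-map _ _)) (∑-cong (λ I → reflexive (rsum-map _ _)) _)) (Sh α β)) ⟩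
    ∑ (λ γS → ijSum (Tset (proj₂ γS)) N h (proj₁ γS)) (Sh α β)
      ≡⟨ P.cong (∑ (λ γS → ijSum (Tset (proj₂ γS)) N h (proj₁ γS))) (shuf≡map-encode 0 α β) ⟩
    ∑ (λ γS → ijSum (Tset (proj₂ γS)) N h (proj₁ γS)) (map (encode 0) (shuffles α β))
      ≡⟨ ∑-map _ (encode 0) (shuffles α β) ⟩
    ∑ (λ w → ijSum (Tset (positions 1 (flags w))) N h (letters w)) (shuffles α β)
      ≈⟨ ∑-congᴬ perWord (length-shuffles α β) ⟩
    shuffleSum α β e ∎
    where
    N = length α N.+ length β
    h = λ δ → η δ e
    perWord : ∀ w → length w ≡ N → ijSum (Tset (positions 1 (flags w))) N h (letters w) ≈ wordTerm e w
    perWord w |w|≡N = begin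
      ijSum (Tset (positions 1 (flags w))) N h (letters w)
        ≡⟨ P.cong (λ T → ijSum T N h (letters w)) (Tset-positions 1 (flags w)) ⟩
      ijSum (runEndPositions w) N h (letters w)
        ≈⟨ ijSum≈mergeAll (runEndPositions w) N h (letters w) (runEnds-sparse 1 (flags w)) (positions-≥ 1 (runEnds (flags w)))
                          (P.subst (λ n → All (_≤ n) (runEndPositions w)) |w|≡N (runEndPositions-≤ w)) (P.trans (LP.length-map proj₁ w) |w|≡N) ⟩
      mergeAll (runEndPositions w) N h (letters w)
        ≡⟨ P.cong (λ n → mergeAll (runEndPositions w) n h (letters w)) |w|≡N ⟨
      wordTerm e w ∎

corollary3p5 : ∀ {c ℓ} (R : CommutativeRing c ℓ) (q : CommutativeRing.Carrier R)
                 (α β : List ℕ) → IsComposition α → IsComposition β →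
                 (e : List ℕ) →
                 CommutativeRing._≈_ R
                   (Enriched._⊗_ R q (Enriched.η R q α) (Enriched.η R q β) e)
                   (Enriched.rhs R q α β e)
corollary3p5 R q α β _ _ e =
  CommutativeRing.trans R (⊗-η≈shuffleSum R q e α β) (CommutativeRing.sym R (rhs≈shuffleSum R q α β e))
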